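{- The coproduct $\Delta:\mathcal M\to\mathcal M\otimes\mathcal M$, $\Delta[\mathsf M,\eta]=\sum_{S\subseteq E(\mathsf M)}[\mathsf M|S,\eta|S]\otimes[\mathsf M/S,\eta/S]$, is well defined, coassociative, and counital with counit $\epsilon:\mathcal M_\bullet\to\mathbb Q$ given by $\epsilon([\varnothing,1])=1$ and $\epsilon=0$ on all other classes.
   Context: An orientation of a matroid $\mathsf M$ is a generator $\eta$ of $\bigwedge^{|E|}\mathbb{Z}\langle E\rangle$, $E=E(\mathsf M)$; $\varnothing$ has orientation $1$. $\mathcal M$ is the $\mathbb{Q}$-vector space spanned by symbols $[\mathsf M,\eta]$ modulo $[\mathsf M,-\eta]=-[\mathsf M,\eta]$ and $[\mathsf M,\eta]=[\mathsf M',\psi_*\eta]$ for every matroid isomorphism $\psi:\mathsf M\to\mathsf M'$ ($\psi_*$ the induced map on top exterior powers), graded by ground-set size ($\mathcal M_\bullet$). For $S\subseteq E$, $\mathsf M|S$ is the restriction and $\mathsf M/S$ the contraction; $\eta|S$ and $\eta/S$ denote any generators of $\bigwedge^{|S|}\mathbb Z\langle S\rangle$ and $\bigwedge^{|E\setminus S|}\mathbb Z\langle E\setminus S\rangle$ with $(\eta|S)\wedge(\eta/S)=\eta$ (such a pair is unique up to simultaneous sign change; for $S=\varnothing$ take $\eta|\varnothing=1$, $\eta/\varnothing=\eta$, and for $S=E$ take $\eta|E=\eta$, $\eta/E=1$). Well-definedness means the formula is independent of these choices and respects the defining relations of $\mathcal M$. -}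

module Defs where

open import Data.Nat using (ℕ; zero; suc; _≤_; _<ᵇ_) renaming (_+_ to _+ℕ_; _∸_ to _∸_)
open import Data.Fin using (Fin; toℕ)
open import Data.Fin.Subset using (Subset; _∈_; _⊆_; _∪_; _∩_; _─_; ∣_∣; ⊥; inside; outside)
open import Data.Fin.Subset.Properties using (_⊆?_)
open import Data.Bool using (Bool; true; false; _∧_; not; if_then_else_)
open import Data.List using (List; []; _∷_; _++_; map; concatMap; filter; allFin; foldr)
open import Data.Nat.ListAction using (sum)
open import Data.Vec using (lookup)
open import Data.Product using (_×_; _,_; Σ; ∃; ∃-syntax; proj₁; proj₂)
open import Data.Sign using (Sign; opposite) renaming (+ to ⊕; - to ⊖; _*_ to _*ₛ_)
open import Data.Rational using (ℚ; 0ℚ; 1ℚ; -_; _*_; _+_)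
open import Relation.Binary.PropositionalEquality using (_≡_)
open import Function using (_⇔_)

-- A matroid is presented with a finite ground set E that is a
-- subset of an ambient Fin n (so restriction/contraction need no
-- relabelling), via its rank function (rank axioms R1–R3 on subsets of E).

record IsMatroid (n : ℕ) (E : Subset n) (rk : Subset n → ℕ) : Set where
  field
    rk-bound : ∀ X → X ⊆ E → rk X ≤ ∣ X ∣
    rk-mono  : ∀ X Y → X ⊆ E → Y ⊆ E → X ⊆ Y → rk X ≤ rk Y
    rk-sub   : ∀ X Y → X ⊆ E → Y ⊆ E → rk (X ∪ Y) +ℕ rk (X ∩ Y) ≤ rk X +ℕ rk Y

-- The top exterior power of ℤ⟨E⟩ is free of rank one
-- with basis the wedge e₁ ∧ … ∧ e_k of the elements of E in increasing
-- order; a generator η is therefore ± that wedge, recorded by a Sign.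
-- (For E = ∅ the wedge is 1, so orientation 1 is ⊕.)
record Sym : Set where
  constructor sym
  field
    amb    : ℕ
    ground : Subset amb
    rank   : Subset amb → ℕ
    orient : Sign
open Sym public

IsMatroidSym : Sym → Set
IsMatroidSym g = IsMatroid (amb g) (ground g) (rank g)

flipO : Sym → Sym
flipO (sym n E r s) = sym n E r (opposite s)

parity : ℕ → Sign
parity zero    = ⊕
parity (suc k) = opposite (parity k)

countPairs : ∀ n → (Fin n → Fin n → Bool) → ℕ
countPairs n P =
  sum (concatMap (λ x → map (λ y → if P x y then 1 else 0) (allFin n)) (allFin n))

-- e_S ∧ e_{E∖S} = shuffleSign E S · e_E  (inversions (s,t), s∈S, t∈E∖S, t<s)
shuffleSign : ∀ {n} → Subset n → Subset n → Sign
shuffleSign {n} E S = parity (countPairs n (λ x y →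
  lookup S x ∧ (lookup E y ∧ (not (lookup S y) ∧ (toℕ y <ᵇ toℕ x)))))

-- ψ(e_{x₁}) ∧ … ∧ ψ(e_{x_k}) = mapSign ψ E · e_{E'}  (x₁ < … < x_k in E)
mapSign : ∀ {n n'} → (Fin n → Fin n') → Subset n → Sign
mapSign {n} ψ E = parity (countPairs n (λ x y →
  lookup E x ∧ (lookup E y ∧ ((toℕ x <ᵇ toℕ y) ∧ (toℕ (ψ y) <ᵇ toℕ (ψ x))))))

-- Isomorphisms of oriented symbols:  Iso g h  says h = [M' , ψ_* η] for a
-- matroid isomorphism ψ : M → M' where g = [M , η].

record Iso (g h : Sym) : Set where
  field
    ψ      : Fin (amb g) → Fin (amb h)
    into   : ∀ x → x ∈ ground g → ψ x ∈ ground h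
    inj    : ∀ x y → x ∈ ground g → y ∈ ground g → ψ x ≡ ψ y → x ≡ y
    onto   : ∀ y → y ∈ ground h → ∃[ x ] (x ∈ ground g × ψ x ≡ y)
    rank-ψ : ∀ X Y → X ⊆ ground g → Y ⊆ ground h →
             (∀ y → (y ∈ Y) ⇔ (∃[ x ] (x ∈ X × ψ x ≡ y))) →
             rank h Y ≡ rank g X
    orient-ψ : orient h ≡ mapSign ψ (ground g) *ₛ orient g

-- Given generating relations
-- G q a r b  (meaning q·a = r·b in the quotient), Cong G is the smallest
-- congruence making Lin A the ℚ-vector space  ℚ⟨A⟩ / span(relations).

Lin : Set → Set
Lin A = List (ℚ × A)

GenRel : Set → Set₁
GenRel A = ℚ → A → ℚ → A → Set

data Cong {A : Set} (G : GenRel A) : Lin A → Lin A → Set where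
  c-refl  : ∀ {x} → Cong G x x
  c-sym   : ∀ {x y} → Cong G x y → Cong G y x
  c-trans : ∀ {x y z} → Cong G x y → Cong G y z → Cong G x z
  c-++    : ∀ {x x' y y'} → Cong G x x' → Cong G y y' → Cong G (x ++ y) (x' ++ y')
  c-swap  : ∀ {p p'} → Cong G (p ∷ p' ∷ []) (p' ∷ p ∷ [])
  c-merge : ∀ {q r a} → Cong G ((q , a) ∷ (r , a) ∷ []) ((q + r , a) ∷ [])
  c-zero  : ∀ {a} → Cong G ((0ℚ , a) ∷ []) []
  c-gen   : ∀ {q a r b} → G q a r b → Cong G ((q , a) ∷ []) ((r , b) ∷ [])

data GenM : GenRel Sym where
  gen-neg : ∀ q g → GenM q (flipO g) (- q) g
  gen-iso : ∀ q g h → Iso g h → GenM q g q h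

-- relations of a tensor product A ⊗ B of two presented spaces
data GenT {A B : Set} (G₁ : GenRel A) (G₂ : GenRel B) : GenRel (A × B) where
  gen-l : ∀ {q r a a' b} → G₁ q a r a' → GenT G₁ G₂ q (a , b) r (a' , b)
  gen-r : ∀ {q r a b b'} → G₂ q b r b' → GenT G₁ G₂ q (a , b) r (a , b')

_≈M_ : Lin Sym → Lin Sym → Set
_≈M_ = Cong GenM

_≈MM_ : Lin (Sym × Sym) → Lin (Sym × Sym) → Set
_≈MM_ = Cong (GenT GenM GenM)

_≈MMM_ : Lin (Sym × (Sym × Sym)) → Lin (Sym × (Sym × Sym)) → Set
_≈MMM_ = Cong (GenT GenM (GenT GenM GenM))

AllMatroid : Lin Sym → Set
AllMatroid [] = Data.Unit.⊤ where import Data.Unit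
AllMatroid ((q , g) ∷ x) = IsMatroidSym g × AllMatroid x

allSubsets : ∀ n → List (Subset n)
allSubsets zero    = Data.Vec.[] ∷ []
allSubsets (suc n) = map (inside Data.Vec.∷_) (allSubsets n) ++ map (outside Data.Vec.∷_) (allSubsets n)

subsetsOf : ∀ {n} → Subset n → List (Subset n)
subsetsOf {n} E = filter (_⊆? E) (allSubsets n)

restrict : (g : Sym) → Subset (amb g) → Sign → Sym
restrict (sym n E r s) S a = sym n S r a

contract : (g : Sym) → Subset (amb g) → Sign → Sym
contract (sym n E r s) S b = sym n (E ─ S) (λ X → r (X ∪ S) ∸ r S) b

-- A choice of (η|S , η/S) for every S ⊆ E: any pair of generators with
-- (η|S) ∧ (η/S) = η.
Choice : Sym → Set
Choice g = Σ (Subset (amb g) → Sign × Sign) λ c →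
  ∀ S → S ⊆ ground g → (proj₁ (c S) *ₛ proj₂ (c S)) *ₛ shuffleSign (ground g) S ≡ orient g

ΔWith : (g : Sym) → Choice g → Lin (Sym × Sym)
ΔWith g (c , _) = map (λ S → 1ℚ , (restrict g S (proj₁ (c S)) , contract g S (proj₂ (c S))))
                      (subsetsOf (ground g))

canonSigns : (g : Sym) → Subset (amb g) → Sign × Sign
canonSigns g S = ⊕ , (orient g *ₛ shuffleSign (ground g) S)

Δ : Sym → Lin (Sym × Sym)
Δ g = map (λ S → 1ℚ , (restrict g S (proj₁ (canonSigns g S)) , contract g S (proj₂ (canonSigns g S))))
          (subsetsOf (ground g))

scale : ∀ {A} → ℚ → Lin A → Lin A
scale q = map (λ { (r , a) → (q * r , a) })

Δ̂ : Lin Sym → Lin (Sym × Sym)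
Δ̂ = concatMap (λ { (q , g) → scale q (Δ g) })

Δ⊗id : Lin (Sym × Sym) → Lin (Sym × (Sym × Sym))
Δ⊗id = concatMap (λ { (q , (a , b)) →
  map (λ { (r , (a₁ , a₂)) → (q * r , (a₁ , (a₂ , b))) }) (Δ a) })

id⊗Δ : Lin (Sym × Sym) → Lin (Sym × (Sym × Sym))
id⊗Δ = concatMap (λ { (q , (a , b)) →
  map (λ { (r , (b₁ , b₂)) → (q * r , (a , (b₁ , b₂))) }) (Δ b) })

signℚ : Sign → ℚ
signℚ ⊕ = 1ℚ
signℚ ⊖ = - 1ℚ

isZero : ℕ → Bool
isZero zero    = true
isZero (suc _) = false

-- ε[∅ , 1] = 1 (hence ε[∅ , -1] = -1 by linearity), ε = 0 on other classes
ε : Sym → ℚ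
ε g = if isZero ∣ ground g ∣ then signℚ (orient g) else 0ℚ

ε̂ : Lin Sym → ℚ
ε̂ = foldr (λ { (q , g) acc → q * ε g + acc }) 0ℚ

ε⊗id : Lin (Sym × Sym) → Lin Sym
ε⊗id = map (λ { (q , (a , b)) → (q * ε a , b) })

id⊗ε : Lin (Sym × Sym) → Lin Sym
id⊗ε = map (λ { (q , (a , b)) → (q * ε b , a) })

-- Signs (-1)^k are handled as products of (-1)^[P x y] over pairs of points, so that mapSign and
-- shuffleSign become double products over pairs of subsets, multiplicative in each subset.  Two
-- sign identities carry the proof.
--
-- For T ⊆ S ⊆ E, both shuffle(S,T)·shuffle(E,S) and shuffle(E,T)·shuffle(E∖T,S∖T) count each
-- inversion between T, S∖T and E∖S once.  With (M/T)/(S∖T) = M/S this matches the term (S,T) of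
-- (Δ⊗id)Δ with the term (T,S∖T) of (id⊗Δ)Δ, and (S,T) ↦ (T,S∖T) is a bijection of the index sets.
--
-- For a bijection ψ : E → E′, the inversions of ψ are those inside S, those inside E∖S, and the
-- crossing pairs whose order ψ reverses; the latter have sign shuffle(E,S)·shuffle(E′,ψS).  Hence an
-- isomorphism ψ sends the term S of Δ[M,η] to the term ψS of Δ[M′,ψ_*η].
--
-- Otherwise two terms differ only by flipping the orientations of both tensor factors, a relation
-- of 𝓜 ⊗ 𝓜.  For the counit, only S = ∅ survives in (ε⊗id)Δ and only S = E in (id⊗ε)Δ.

module Submission where

open import Algebra.Bundles using (CommutativeMonoid)
open import Data.Bool using (Bool; true; false; _∧_; _∨_; not; if_then_else_)
open import Data.Bool.Properties using (∧-zeroʳ; ∧-identityʳ; ∧-assoc; T-≡)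
import Data.Empty
open import Data.Empty using (⊥-elim)
open import Data.Fin using (Fin; zero; suc; toℕ; _≟_)
open import Data.Fin.Properties using (any?; toℕ-injective)
open import Data.Fin.Subset using (Subset; _∈_; _∉_; _⊆_; _∪_; _∩_; _─_; ⊥; ∣_∣; Empty; Nonempty)
open import Data.Fin.Subset.Properties
  using ( _∈?_; _⊆?_; nonempty?; ∉⊥; ⊥⊆; ⊆-refl; ⊆-trans; ⊆-antisym; ∣⊥∣≡0; x∈p⇒∣p-x∣<∣p∣; Empty-unique
        ; x∈p∪q⁻; x∈p∪q⁺; p⊆p∪q; ∪-comm; ∪-assoc; ∪-identityʳ; p∩q⊆p; x∈p∩q⁺; x∈p∩q⁻
        ; x∈p∧x∉q⇒x∈p─q; p─q⊆p; p─⊥≡p; p─q─r≡p─q∪r )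
open import Data.List using (List; []; _∷_; _++_; map; filter; foldr; concatMap; allFin)
open import Data.List.Membership.Propositional using () renaming (_∈_ to _∈L_)
open import Data.List.Membership.Propositional.Properties
  using (∈-filter⁺; ∈-filter⁻; ∈-allFin; ∈-map⁺; ∈-map⁻; ∈-++⁺ˡ; ∈-++⁺ʳ; ∈-++⁻)
open import Data.List.Membership.Propositional.Properties.WithK using (unique∧set⇒bag)
open import Data.List.Properties using (map-∘; map-++; concatMap-map; concatMap-++; ++-identityʳ; filter-none)
open import Data.List.Relation.Binary.BagAndSetEquality using (∼bag⇒↭)
open import Data.List.Relation.Binary.Permutation.Propositional
  using (_↭_; refl; prep; swap; trans; ↭-sym)
open import Data.List.Relation.Binary.Permutation.Propositional.Properties using (shift; shifts; map⁺)
import Data.List.Relation.Unary.All as All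
import Data.List.Relation.Unary.All.Properties as Allₚ
open import Data.List.Relation.Unary.AllPairs using ([]; _∷_)
open import Data.List.Relation.Unary.Any using (here; there)
open import Data.List.Relation.Unary.Unique.Propositional using (Unique)
import Data.List.Relation.Unary.Unique.Propositional.Properties as Unique
open import Data.Nat using (ℕ; zero; suc; _≤_; _∸_; _<ᵇ_) renaming (_+_ to _+ℕ_)
open import Data.Nat.ListAction using (sum)
open import Data.Nat.Properties using (<ᵇ-reflects-<; <-asym; ≤-antisym; ≮⇒≥; n≤0⇒n≡0; ∸-+-assoc; m+[n∸m]≡n)
open import Data.Product using (_×_; _,_; proj₁; proj₂; ∃-syntax; uncurry)
open import Data.Rational using (ℚ; 0ℚ; 1ℚ; -_; _*_; _+_)
open import Data.Rational.Properties
  using ( *-identityˡ; *-zeroˡ; *-zeroʳ; *-distribʳ-+; +-identityˡ; +-identityʳ; +-assoc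
        ; neg-distribˡ-*; neg-distribʳ-*; +-0-group; +-0-commutativeMonoid )
open import Data.Sign using (Sign; opposite) renaming (+ to ⊕; - to ⊖; _*_ to _*ₛ_)
open import Data.Sign.Properties
  using (*-identityʳ; *-assoc; *-comm; *-cancelʳ-≡; s*s≡+; opposite-injective; opposite-involutive)
open import Data.Sum using (_⊎_; inj₁; inj₂)
open import Data.Vec using ([]; _∷_; lookup; tabulate)
open import Data.Vec.Properties
  using ([]=⇒lookup; lookup⇒[]=; lookup-zipWith; lookup∘tabulate; tabulate∘lookup; tabulate-cong; ∷-injectiveʳ)
open import Function using (_∘_; _⇔_; mk⇔; Equivalence)
open import Relation.Binary.Bundles using (Setoid)
open import Relation.Binary.PropositionalEquality as ≡
  using (_≡_; _≢_; refl; cong; cong₂; module ≡-Reasoning)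
import Relation.Binary.Reasoning.Setoid as SetoidReasoning
open import Relation.Nullary.Decidable using (Dec; yes; no; does; T?; _×-dec_)
open import Relation.Nullary.Reflects using (ofʸ; ofⁿ)
open import Relation.Unary using (Decidable)

open import Algebra.Properties.CommutativeSemigroup Data.Sign.Properties.*-commutativeSemigroup
  using (interchange; x∙yz≈y∙xz; xy∙z≈y∙xz)
open import Algebra.Properties.CommutativeSemigroup (CommutativeMonoid.commutativeSemigroup +-0-commutativeMonoid)
  using () renaming (x∙yz≈y∙xz to +-x∙yz≈y∙xz)
open import Algebra.Properties.Group +-0-group using (⁻¹-involutive)
open Equivalence using (to; from)

open import Defs

private
  variable
    A B : Set
    m n : ℕ

-- Products of signs

sgn : Bool → Sign
sgn true  = ⊖
sgn false = ⊕

∏ : List A → (A → Sign) → Sign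
∏ xs f = foldr (λ x s → f x *ₛ s) ⊕ xs

∏-++ : ∀ xs ys (f : A → Sign) → ∏ (xs ++ ys) f ≡ ∏ xs f *ₛ ∏ ys f
∏-++ []       ys f = refl
∏-++ (x ∷ xs) ys f = ≡.trans (cong (f x *ₛ_) (∏-++ xs ys f)) (≡.sym (*-assoc (f x) _ _))

∏-* : ∀ xs (f g : A → Sign) → ∏ xs (λ x → f x *ₛ g x) ≡ ∏ xs f *ₛ ∏ xs g
∏-* []       f g = refl
∏-* (x ∷ xs) f g = ≡.trans (cong (f x *ₛ g x *ₛ_) (∏-* xs f g)) (interchange (f x) (g x) _ _)

∏-⊕ : ∀ (xs : List A) → ∏ xs (λ _ → ⊕) ≡ ⊕
∏-⊕ []       = refl
∏-⊕ (x ∷ xs) = ∏-⊕ xs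

∏-cong : ∀ xs {f g : A → Sign} → (∀ x → f x ≡ g x) → ∏ xs f ≡ ∏ xs g
∏-cong []       f≗g = refl
∏-cong (x ∷ xs) f≗g = cong₂ _*ₛ_ (f≗g x) (∏-cong xs f≗g)

∏-cong-∈ : ∀ xs {f g : A → Sign} → (∀ x → x ∈L xs → f x ≡ g x) → ∏ xs f ≡ ∏ xs g
∏-cong-∈ []       f≗g = refl
∏-cong-∈ (x ∷ xs) f≗g = cong₂ _*ₛ_ (f≗g x (here refl)) (∏-cong-∈ xs λ y y∈ → f≗g y (there y∈))

∏-↭ : ∀ {xs ys} (f : A → Sign) → xs ↭ ys → ∏ xs f ≡ ∏ ys f
∏-↭ f refl                   = refl
∏-↭ f (prep x p)             = cong (f x *ₛ_) (∏-↭ f p)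
∏-↭ f (swap {ys = ys} x y p) =
  ≡.trans (cong (λ s → f x *ₛ (f y *ₛ s)) (∏-↭ f p)) (x∙yz≈y∙xz (f x) (f y) (∏ ys f))
∏-↭ f (trans p q)            = ≡.trans (∏-↭ f p) (∏-↭ f q)

∏-filter : ∀ {P : A → Set} (P? : Decidable P) xs (f : A → Sign) →
           ∏ (filter P? xs) f ≡ ∏ xs (λ x → if does (P? x) then f x else ⊕)
∏-filter P? []       f = refl
∏-filter P? (x ∷ xs) f with does (P? x)
... | true  = cong (f x *ₛ_) (∏-filter P? xs f)
... | false = ∏-filter P? xs f

∏-map : ∀ (g : B → A) xs (f : A → Sign) → ∏ (map g xs) f ≡ ∏ xs (f ∘ g)
∏-map g []       f = refl
∏-map g (x ∷ xs) f = cong (f (g x) *ₛ_) (∏-map g xs f)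

∏-concatMap : ∀ (F : A → List B) xs (f : B → Sign) → ∏ (concatMap F xs) f ≡ ∏ xs (λ x → ∏ (F x) f)
∏-concatMap F []       f = refl
∏-concatMap F (x ∷ xs) f =
  ≡.trans (∏-++ (F x) (concatMap F xs) f) (cong (∏ (F x) f *ₛ_) (∏-concatMap F xs f))

∏-comm : ∀ xs (ys : List B) (f : A → B → Sign) →
         ∏ xs (λ x → ∏ ys (f x)) ≡ ∏ ys (λ y → ∏ xs (λ x → f x y))
∏-comm []       ys f = ≡.sym (∏-⊕ ys)
∏-comm (x ∷ xs) ys f = ≡.trans (cong (∏ ys (f x) *ₛ_) (∏-comm xs ys f)) (≡.sym (∏-* ys (f x) _))

parity-+ : ∀ i j → parity (i +ℕ j) ≡ parity i *ₛ parity j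
parity-+ zero    j = refl
parity-+ (suc i) j = ≡.trans (cong (⊖ *ₛ_) (parity-+ i j)) (≡.sym (*-assoc ⊖ (parity i) (parity j)))

parity-sum : ∀ ns → parity (sum ns) ≡ ∏ ns parity
parity-sum []       = refl
parity-sum (i ∷ ns) = ≡.trans (parity-+ i (sum ns)) (cong (parity i *ₛ_) (parity-sum ns))

parity-countPairs : ∀ n (P : Fin n → Fin n → Bool) →
  parity (countPairs n P) ≡ ∏ (allFin n) λ x → ∏ (allFin n) λ y → sgn (P x y)
parity-countPairs n P = begin
  parity (countPairs n P)
    ≡⟨ parity-sum (concatMap (λ x → map (indicator x) (allFin n)) (allFin n)) ⟩
  ∏ (concatMap (λ x → map (indicator x) (allFin n)) (allFin n)) parity
    ≡⟨ ∏-concatMap _ (allFin n) parity ⟩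
  ∏ (allFin n) (λ x → ∏ (map (indicator x) (allFin n)) parity)
    ≡⟨ ∏-cong (allFin n) (λ x → ∏-map (indicator x) (allFin n) parity) ⟩
  ∏ (allFin n) (λ x → ∏ (allFin n) (parity ∘ indicator x))
    ≡⟨ ∏-cong (allFin n) (λ x → ∏-cong (allFin n) (λ y → parity-indicator (P x y))) ⟩
  ∏ (allFin n) (λ x → ∏ (allFin n) (λ y → sgn (P x y)))
    ∎
  where
  open ≡-Reasoning
  indicator : Fin n → Fin n → ℕ
  indicator x y = if P x y then 1 else 0
  parity-indicator : ∀ b → parity (if b then 1 else 0) ≡ sgn b
  parity-indicator true  = refl
  parity-indicator false = refl

-- Lists without repetition

unique-map⁺ : ∀ {f : A → B} {xs} → (∀ {x y} → x ∈L xs → y ∈L xs → f x ≡ f y → x ≡ y) →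
              Unique xs → Unique (map f xs)
unique-map⁺ inj []           = []
unique-map⁺ inj (x∉xs ∷ xs!) =
  Allₚ.map⁺ (All.tabulate λ y∈xs fx≡fy → All.lookup x∉xs y∈xs (inj (here refl) (there y∈xs) fx≡fy))
  ∷ unique-map⁺ (λ x∈ y∈ → inj (there x∈) (there y∈)) xs!

map-↭ : ∀ {f : A → B} {xs ys} → Unique xs → Unique ys →
        (∀ {x y} → x ∈L xs → y ∈L xs → f x ≡ f y → x ≡ y) →
        (∀ {y} → y ∈L ys ⇔ (∃[ x ] (x ∈L xs × f x ≡ y))) →
        map f xs ↭ ys
map-↭ {f = f} xs! ys! inj ys-image = ∼bag⇒↭ (unique∧set⇒bag (unique-map⁺ inj xs!) ys! (mk⇔
  (λ y∈ → let x , x∈ , y≡fx = ∈-map⁻ f y∈ in from ys-image (x , x∈ , ≡.sym y≡fx))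
  (λ y∈ → let x , x∈ , fx≡y = to ys-image y∈ in ≡.subst (_∈L map f _) fx≡y (∈-map⁺ f x∈))))

pairs : List A → (A → List B) → List (A × B)
pairs xs L = concatMap (λ x → map (x ,_) (L x)) xs

module _ {L : A → List B} where

  ∈-pairs⁺ : ∀ {xs a b} → a ∈L xs → b ∈L L a → (a , b) ∈L pairs xs L
  ∈-pairs⁺ {x ∷ xs} (here refl) b∈ = ∈-++⁺ˡ (∈-map⁺ (x ,_) b∈)
  ∈-pairs⁺ {x ∷ xs} (there a∈)  b∈ = ∈-++⁺ʳ (map (x ,_) (L x)) (∈-pairs⁺ a∈ b∈)

  ∈-pairs⁻ : ∀ xs {a b} → (a , b) ∈L pairs xs L → a ∈L xs × b ∈L L a
  ∈-pairs⁻ (x ∷ xs) ab∈ with ∈-++⁻ (map (x ,_) (L x)) ab∈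
  ... | inj₂ ab∈xs = let a∈ , b∈ = ∈-pairs⁻ xs ab∈xs in there a∈ , b∈
  ... | inj₁ ab∈x with ∈-map⁻ (x ,_) ab∈x
  ...   | _ , b∈ , refl = here refl , b∈

  pairs-unique : ∀ {xs} → Unique xs → (∀ a → Unique (L a)) → Unique (pairs xs L)
  pairs-unique {[]}     []           L! = []
  pairs-unique {x ∷ xs} (x∉xs ∷ xs!) L! =
    Unique.++⁺ (Unique.map⁺ (cong proj₂) (L! x)) (pairs-unique xs! L!) disjoint
    where
    disjoint : ∀ {p} → p ∈L map (x ,_) (L x) × p ∈L pairs xs L → Data.Empty.⊥
    disjoint (p∈x , p∈xs) with ∈-map⁻ (x ,_) p∈x
    ... | _ , _ , refl = All.lookup x∉xs (proj₁ (∈-pairs⁻ xs p∈xs)) refl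

  concatMap-pairs : ∀ {C : Set} (K : A → List C) (F : A → B → C) xs →
                    (∀ x → K x ≡ map (F x) (L x)) → concatMap K xs ≡ map (uncurry F) (pairs xs L)
  concatMap-pairs K F []       K≗ = refl
  concatMap-pairs K F (x ∷ xs) K≗ = begin
    K x ++ concatMap K xs                            ≡⟨ cong₂ _++_ (K≗ x) (concatMap-pairs K F xs K≗) ⟩
    map (F x) (L x) ++ map (uncurry F) (pairs xs L)  ≡⟨ cong (_++ _) (map-∘ (L x)) ⟩
    map (uncurry F) (map (x ,_) (L x)) ++ map (uncurry F) (pairs xs L)
      ≡⟨ map-++ _ (map (x ,_) (L x)) (pairs xs L) ⟨
    map (uncurry F) (pairs (x ∷ xs) L)               ∎
    where open ≡-Reasoning

-- Subsets

∈⇔lookup : ∀ {x} {p : Subset n} → x ∈ p ⇔ lookup p x ≡ true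
∈⇔lookup {x = x} {p} = mk⇔ []=⇒lookup (lookup⇒[]= x p)

∉⇒lookup : ∀ {x} {p : Subset n} → x ∉ p → lookup p x ≡ false
∉⇒lookup {x = x} {p} x∉p with lookup p x in eq
... | true  = ⊥-elim (x∉p (from ∈⇔lookup eq))
... | false = refl

lookup-∪ : ∀ (p q : Subset n) x → lookup (p ∪ q) x ≡ lookup p x ∨ lookup q x
lookup-∪ p q x = lookup-zipWith _∨_ x p q

lookup-─ : ∀ (p q : Subset n) x → lookup (p ─ q) x ≡ lookup p x ∧ not (lookup q x)
lookup-─ (a ∷ p) (true  ∷ q) zero    = ≡.sym (∧-zeroʳ a)
lookup-─ (a ∷ p) (false ∷ q) zero    = ≡.sym (∧-identityʳ a)
lookup-─ (_ ∷ p) (_     ∷ q) (suc x) = lookup-─ p q x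

lookup-⊆ : ∀ {p q : Subset n} → p ⊆ q → ∀ x → lookup p x ≡ true → lookup q x ≡ true
lookup-⊆ p⊆q x = to ∈⇔lookup ∘ p⊆q ∘ from ∈⇔lookup

lookup-injective : ∀ {p q : Subset n} → (∀ x → lookup p x ≡ lookup q x) → p ≡ q
lookup-injective {p = p} {q} p≗q =
  ≡.trans (≡.sym (tabulate∘lookup p)) (≡.trans (tabulate-cong p≗q) (tabulate∘lookup q))

x∈p─q⁻ : ∀ {x} {p q : Subset n} → x ∈ p ─ q → x ∈ p × x ∉ q
x∈p─q⁻ {x = x} {p} {q} x∈p─q = p─q⊆p p q x∈p─q , λ x∈q → true≢false (begin
  true                          ≡⟨ to ∈⇔lookup x∈p─q ⟨
  lookup (p ─ q) x              ≡⟨ lookup-─ p q x ⟩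
  lookup p x ∧ not (lookup q x) ≡⟨ cong (λ b → lookup p x ∧ not b) (to ∈⇔lookup x∈q) ⟩
  lookup p x ∧ false            ≡⟨ ∧-zeroʳ (lookup p x) ⟩
  false                         ∎)
  where
  open ≡-Reasoning
  true≢false : true ≢ false
  true≢false ()

∪-⊆ : ∀ {X Y Z : Subset n} → X ⊆ Z → Y ⊆ Z → X ∪ Y ⊆ Z
∪-⊆ {X = X} {Y} X⊆Z Y⊆Z x∈ with x∈p∪q⁻ X Y x∈
... | inj₁ x∈X = X⊆Z x∈X
... | inj₂ x∈Y = Y⊆Z x∈Y

─-monoˡ : ∀ {E S T : Subset n} → S ⊆ E → S ─ T ⊆ E ─ T
─-monoˡ S⊆E x∈ = let x∈S , x∉T = x∈p─q⁻ x∈ in x∈p∧x∉q⇒x∈p─q (S⊆E x∈S) x∉T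

∪-─-⊆ : ∀ {S T : Subset n} → T ⊆ S → T ∪ (S ─ T) ≡ S
∪-─-⊆ {S = S} {T} T⊆S = lookup-injective λ x → begin
  lookup (T ∪ (S ─ T)) x                         ≡⟨ lookup-∪ T (S ─ T) x ⟩
  lookup T x ∨ lookup (S ─ T) x                  ≡⟨ cong (lookup T x ∨_) (lookup-─ S T x) ⟩
  lookup T x ∨ (lookup S x ∧ not (lookup T x))   ≡⟨ absorb (lookup-⊆ T⊆S x) ⟩
  lookup S x                                     ∎
  where
  open ≡-Reasoning
  absorb : ∀ {t s} → (t ≡ true → s ≡ true) → t ∨ (s ∧ not t) ≡ s
  absorb {true}  t⇒s = ≡.sym (t⇒s refl)
  absorb {false} _   = ∧-identityʳ _

∪-─-disjoint : ∀ {E T U : Subset n} → U ⊆ E ─ T → (T ∪ U) ─ T ≡ U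
∪-─-disjoint {T = T} {U} U⊆E─T = lookup-injective λ x → begin
  lookup ((T ∪ U) ─ T) x                        ≡⟨ lookup-─ (T ∪ U) T x ⟩
  lookup (T ∪ U) x ∧ not (lookup T x)           ≡⟨ cong (λ b → b ∧ not (lookup T x)) (lookup-∪ T U x) ⟩
  (lookup T x ∨ lookup U x) ∧ not (lookup T x)  ≡⟨ cancel (U⇒¬T x) ⟩
  lookup U x                                    ∎
  where
  open ≡-Reasoning
  U⇒¬T : ∀ x → lookup U x ≡ true → lookup T x ≡ false
  U⇒¬T x = ∉⇒lookup ∘ proj₂ ∘ x∈p─q⁻ ∘ U⊆E─T ∘ from ∈⇔lookup
  cancel : ∀ {t u} → (u ≡ true → t ≡ false) → (t ∨ u) ∧ not t ≡ u
  cancel {true}  {true}  u⇒¬t = ≡.sym (u⇒¬t refl)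
  cancel {true}  {false} _    = refl
  cancel {false} {u}     _    = ∧-identityʳ u

─-─-⊆ : ∀ {E S T : Subset n} → T ⊆ S → (E ─ T) ─ (S ─ T) ≡ E ─ S
─-─-⊆ {E = E} {S} {T} T⊆S = ≡.trans (p─q─r≡p─q∪r E T (S ─ T)) (cong (E ─_) (∪-─-⊆ T⊆S))

─-cancelʳ : ∀ {S S′ T : Subset n} → T ⊆ S → T ⊆ S′ → S ─ T ≡ S′ ─ T → S ≡ S′
─-cancelʳ {T = T} T⊆S T⊆S′ S─T≡S′─T =
  ≡.trans (≡.sym (∪-─-⊆ T⊆S)) (≡.trans (cong (T ∪_) S─T≡S′─T) (∪-─-⊆ T⊆S′))

Empty-⊥ : Empty (⊥ {n})
Empty-⊥ (_ , x∈⊥) = ∉⊥ x∈⊥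

Empty-─-self : ∀ (p : Subset n) → Empty (p ─ p)
Empty-─-self p (_ , x∈p─p) = let x∈p , x∉p = x∈p─q⁻ x∈p─p in x∉p x∈p

≢⊥⇒Nonempty : ∀ {p : Subset n} → p ≢ ⊥ → Nonempty p
≢⊥⇒Nonempty {p = p} p≢⊥ with nonempty? p
... | yes p-nonempty = p-nonempty
... | no  p-empty    = ⊥-elim (p≢⊥ (Empty-unique p-empty))

─-Nonempty : ∀ {E S : Subset n} → S ⊆ E → S ≢ E → Nonempty (E ─ S)
─-Nonempty {E = E} {S} S⊆E S≢E with nonempty? (E ─ S)
... | yes E─S-nonempty = E─S-nonempty
... | no  E─S-empty    = ⊥-elim (S≢E (⊆-antisym S⊆E E⊆S))
  where
  E⊆S : E ⊆ S
  E⊆S {x} x∈E with x ∈? S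
  ... | yes x∈S = x∈S
  ... | no  x∉S = ⊥-elim (E─S-empty (x , x∈p∧x∉q⇒x∈p─q x∈E x∉S))

allSubsets-complete : ∀ (p : Subset n) → p ∈L allSubsets n
allSubsets-complete []                  = here refl
allSubsets-complete (true ∷ p)          = ∈-++⁺ˡ (∈-map⁺ (true ∷_) (allSubsets-complete p))
allSubsets-complete {suc n} (false ∷ p) =
  ∈-++⁺ʳ (map (true ∷_) (allSubsets n)) (∈-map⁺ (false ∷_) (allSubsets-complete p))

allSubsets-unique : ∀ n → Unique (allSubsets n)
allSubsets-unique zero    = All.[] ∷ []
allSubsets-unique (suc n) = Unique.++⁺ (Unique.map⁺ ∷-injectiveʳ (allSubsets-unique n))
                                       (Unique.map⁺ ∷-injectiveʳ (allSubsets-unique n)) disjoint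
  where
  disjoint : ∀ {p} → p ∈L map (true ∷_) (allSubsets n) × p ∈L map (false ∷_) (allSubsets n) → Data.Empty.⊥
  disjoint (p∈ , p∈′) with ∈-map⁻ (true ∷_) p∈ | ∈-map⁻ (false ∷_) p∈′
  ... | _ , _ , refl | _ , _ , ()

∈-subsetsOf⁺ : ∀ {E S : Subset n} → S ⊆ E → S ∈L subsetsOf E
∈-subsetsOf⁺ {E = E} {S} S⊆E = ∈-filter⁺ (_⊆? E) (allSubsets-complete S) S⊆E

∈-subsetsOf⁻ : ∀ {E S : Subset n} → S ∈L subsetsOf E → S ⊆ E
∈-subsetsOf⁻ {n} {E} S∈ = proj₂ (∈-filter⁻ (_⊆? E) {xs = allSubsets n} S∈)

subsetsOf-unique : ∀ (E : Subset n) → Unique (subsetsOf E)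
subsetsOf-unique {n} E = Unique.filter⁺ (_⊆? E) (allSubsets-unique n)

nestedPairs disjointPairs : Subset n → List (Subset n × Subset n)
nestedPairs   E = pairs (subsetsOf E) subsetsOf
disjointPairs E = pairs (subsetsOf E) (λ T → subsetsOf (E ─ T))

∈-nestedPairs⁻ : ∀ {E S T : Subset n} → (S , T) ∈L nestedPairs E → S ⊆ E × T ⊆ S
∈-nestedPairs⁻ {E = E} ST∈ = let S∈ , T∈ = ∈-pairs⁻ (subsetsOf E) ST∈ in ∈-subsetsOf⁻ S∈ , ∈-subsetsOf⁻ T∈

nestedPairs-disjointPairs : ∀ (E : Subset n) → map (λ (S , T) → T , S ─ T) (nestedPairs E) ↭ disjointPairs E
nestedPairs-disjointPairs E = map-↭
  (pairs-unique (subsetsOf-unique E) subsetsOf-unique)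
  (pairs-unique (subsetsOf-unique E) (λ T → subsetsOf-unique (E ─ T)))
  injective (mk⇔ surjective into)
  where
  split : _ × _ → _ × _
  split (S , T) = T , S ─ T
  injective : ∀ {p q} → p ∈L nestedPairs E → q ∈L nestedPairs E → split p ≡ split q → p ≡ q
  injective {S , T} {S′ , T′} ST∈ S′T′∈ eq with cong proj₁ eq
  ... | refl =
    cong (_, T) (─-cancelʳ (proj₂ (∈-nestedPairs⁻ ST∈)) (proj₂ (∈-nestedPairs⁻ S′T′∈)) (cong proj₂ eq))
  surjective : ∀ {p} → p ∈L disjointPairs E → ∃[ q ] (q ∈L nestedPairs E × split q ≡ p)
  surjective {T , U} TU∈ =
    let T∈ , U∈ = ∈-pairs⁻ (subsetsOf E) TU∈
        T⊆E     = ∈-subsetsOf⁻ T∈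
        U⊆E─T   = ∈-subsetsOf⁻ U∈
    in (T ∪ U , T) , ∈-pairs⁺ (∈-subsetsOf⁺ (∪-⊆ T⊆E (⊆-trans U⊆E─T (p─q⊆p E T)))) (∈-subsetsOf⁺ (p⊆p∪q U))
                   , cong (T ,_) (∪-─-disjoint U⊆E─T)
  into : ∀ {p} → ∃[ q ] (q ∈L nestedPairs E × split q ≡ p) → p ∈L disjointPairs E
  into ((S , T) , ST∈ , refl) = let S⊆E , T⊆S = ∈-nestedPairs⁻ ST∈ in
    ∈-pairs⁺ (∈-subsetsOf⁺ (⊆-trans T⊆S S⊆E)) (∈-subsetsOf⁺ (─-monoˡ S⊆E))

elements : Subset n → List (Fin n)
elements {n} p = filter (T? ∘ lookup p) (allFin n)

∈-elements⇔ : ∀ {x} {p : Subset n} → x ∈L elements p ⇔ x ∈ p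
∈-elements⇔ {n} {x} {p} = mk⇔
  (λ x∈ → from ∈⇔lookup (to T-≡ (proj₂ (∈-filter⁻ (T? ∘ lookup p) {xs = allFin n} x∈))))
  (λ x∈p → ∈-filter⁺ (T? ∘ lookup p) (∈-allFin x) (from T-≡ (to ∈⇔lookup x∈p)))

elements-unique : (p : Subset n) → Unique (elements p)
elements-unique {n} p = Unique.filter⁺ (T? ∘ lookup p) (Unique.allFin⁺ n)

∏-elements : ∀ (p : Subset n) f → ∏ (elements p) f ≡ ∏ (allFin n) (λ x → if lookup p x then f x else ⊕)
∏-elements {n} p f = ∏-filter (T? ∘ lookup p) (allFin n) f

∏-elements-Empty : ∀ {p : Subset n} f → Empty p → ∏ (elements p) f ≡ ⊕
∏-elements-Empty {n} {p} f p-empty =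
  cong (λ xs → ∏ xs f) (filter-none (T? ∘ lookup p) {xs = allFin n} (All.tabulate λ {x} _ x∈p →
    p-empty (x , from ∈⇔lookup (to T-≡ x∈p))))

∏-elements-split : ∀ {A B : Subset n} f → A ⊆ B →
  ∏ (elements B) f ≡ ∏ (elements A) f *ₛ ∏ (elements (B ─ A)) f
∏-elements-split {n} {A} {B} f A⊆B = begin
  ∏ (elements B) f                                      ≡⟨ ∏-elements B f ⟩
  ∏ (allFin n) (on B)                                   ≡⟨ ∏-cong (allFin n) split ⟩
  ∏ (allFin n) (λ x → on A x *ₛ on (B ─ A) x)           ≡⟨ ∏-* (allFin n) (on A) (on (B ─ A)) ⟩
  ∏ (allFin n) (on A) *ₛ ∏ (allFin n) (on (B ─ A))      ≡⟨ cong₂ _*ₛ_ (∏-elements A f) (∏-elements (B ─ A) f) ⟨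
  ∏ (elements A) f *ₛ ∏ (elements (B ─ A)) f            ∎
  where
  open ≡-Reasoning
  on : Subset n → Fin n → Sign
  on p x = if lookup p x then f x else ⊕
  split : ∀ x → on B x ≡ on A x *ₛ on (B ─ A) x
  split x rewrite lookup-─ B A x with lookup A x in a
  ... | true  rewrite lookup-⊆ A⊆B x a = ≡.sym (*-identityʳ (f x))
  ... | false rewrite ∧-identityʳ (lookup B x) = refl

-- Images

IsImage : (Fin m → Fin n) → Subset m → Subset n → Set
IsImage ψ X Y = ∀ y → (y ∈ Y) ⇔ (∃[ x ] (x ∈ X × ψ x ≡ y))

InjectiveOn : (Fin m → Fin n) → Subset m → Set
InjectiveOn ψ X = ∀ x y → x ∈ X → y ∈ X → ψ x ≡ ψ y → x ≡ y

injectiveOn-⊆ : ∀ {ψ : Fin m → Fin n} {E S} → S ⊆ E → InjectiveOn ψ E → InjectiveOn ψ S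
injectiveOn-⊆ S⊆E inj x y x∈S y∈S = inj x y (S⊆E x∈S) (S⊆E y∈S)

∈-tabulate⇔ : ∀ {f : Fin n → Bool} {x} → x ∈ tabulate f ⇔ f x ≡ true
∈-tabulate⇔ {f = f} {x} = mk⇔
  (λ x∈ → ≡.trans (≡.sym (lookup∘tabulate f x)) (to ∈⇔lookup x∈))
  (λ fx → from ∈⇔lookup (≡.trans (lookup∘tabulate f x) fx))

does⇔ : ∀ {P : Set} (P? : Dec P) → does P? ≡ true ⇔ P
does⇔ (yes p) = mk⇔ (λ _ → p) (λ _ → refl)
does⇔ (no ¬p) = mk⇔ (λ ()) (λ p → ⊥-elim (¬p p))

image : (Fin m → Fin n) → Subset m → Subset n
image ψ X = tabulate λ y → does (any? λ x → x ∈? X ×-dec ψ x ≟ y)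

preimage : (Fin m → Fin n) → Subset n → Subset m
preimage ψ Y = tabulate λ x → lookup Y (ψ x)

isImage-image : ∀ (ψ : Fin m → Fin n) X → IsImage ψ X (image ψ X)
isImage-image ψ X y = mk⇔ (to (does⇔ ψ⁻¹y?) ∘ to ∈-tabulate⇔) (from ∈-tabulate⇔ ∘ from (does⇔ ψ⁻¹y?))
  where ψ⁻¹y? = any? λ x → x ∈? X ×-dec ψ x ≟ y

∈-preimage⇔ : ∀ {ψ : Fin m → Fin n} {Y x} → x ∈ preimage ψ Y ⇔ ψ x ∈ Y
∈-preimage⇔ = mk⇔ (from ∈⇔lookup ∘ to ∈-tabulate⇔) (from ∈-tabulate⇔ ∘ to ∈⇔lookup)

isImage-unique : ∀ {ψ : Fin m → Fin n} {X Y Y′} → IsImage ψ X Y → IsImage ψ X Y′ → Y ≡ Y′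
isImage-unique Y-img Y′-img = ⊆-antisym
  (λ {y} y∈ → from (Y′-img y) (to (Y-img y) y∈))
  (λ {y} y∈ → from (Y-img y) (to (Y′-img y) y∈))

isImage-id : ∀ {X Y : Subset n} → IsImage (λ x → x) X Y → Y ≡ X
isImage-id Y-img = isImage-unique Y-img (λ y → mk⇔ (λ y∈ → y , y∈ , refl) λ { (x , x∈ , refl) → x∈ })

isImage-mono : ∀ {ψ : Fin m → Fin n} {X X′ Y Y′} → IsImage ψ X Y → IsImage ψ X′ Y′ → X ⊆ X′ → Y ⊆ Y′
isImage-mono Y-img Y′-img X⊆X′ {y} y∈Y =
  let x , x∈X , ψx≡y = to (Y-img y) y∈Y in from (Y′-img y) (x , X⊆X′ x∈X , ψx≡y)

isImage-∪ : ∀ {ψ : Fin m → Fin n} {X X′ Y Y′} → IsImage ψ X Y → IsImage ψ X′ Y′ →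
            IsImage ψ (X ∪ X′) (Y ∪ Y′)
isImage-∪ {X = X} {X′} {Y} {Y′} Y-img Y′-img y = mk⇔ forth back
  where
  forth : y ∈ Y ∪ Y′ → ∃[ x ] (x ∈ X ∪ X′ × _ ≡ y)
  forth y∈ with x∈p∪q⁻ Y Y′ y∈
  ... | inj₁ y∈Y  = let x , x∈ , eq = to (Y-img y) y∈Y   in x , x∈p∪q⁺ (inj₁ x∈) , eq
  ... | inj₂ y∈Y′ = let x , x∈ , eq = to (Y′-img y) y∈Y′ in x , x∈p∪q⁺ (inj₂ x∈) , eq
  back : ∃[ x ] (x ∈ X ∪ X′ × _ ≡ y) → y ∈ Y ∪ Y′
  back (x , x∈ , eq) with x∈p∪q⁻ X X′ x∈
  ... | inj₁ x∈X  = x∈p∪q⁺ (inj₁ (from (Y-img y) (x , x∈X , eq)))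
  ... | inj₂ x∈X′ = x∈p∪q⁺ (inj₂ (from (Y′-img y) (x , x∈X′ , eq)))

isImage-─ : ∀ {ψ : Fin m → Fin n} {E E′ S S′} → InjectiveOn ψ E → IsImage ψ E E′ →
            S ⊆ E → IsImage ψ S S′ → IsImage ψ (E ─ S) (E′ ─ S′)
isImage-─ {ψ = ψ} {E} {E′} {S} {S′} inj E′-img S⊆E S′-img y = mk⇔ forth back
  where
  forth : y ∈ E′ ─ S′ → ∃[ x ] (x ∈ E ─ S × ψ x ≡ y)
  forth y∈ =
    let y∈E′ , y∉S′    = x∈p─q⁻ y∈
        x , x∈E , ψx≡y = to (E′-img y) y∈E′
    in x , x∈p∧x∉q⇒x∈p─q x∈E (λ x∈S → y∉S′ (from (S′-img y) (x , x∈S , ψx≡y))) , ψx≡y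
  back : ∃[ x ] (x ∈ E ─ S × ψ x ≡ y) → y ∈ E′ ─ S′
  back (x , x∈ , ψx≡y) = x∈p∧x∉q⇒x∈p─q (from (E′-img y) (x , x∈E , ψx≡y)) y∉S′
    where
    x∈E = proj₁ (x∈p─q⁻ x∈)
    y∉S′ : y ∉ S′
    y∉S′ y∈S′ =
      let x′ , x′∈S , ψx′≡y = to (S′-img y) y∈S′
          x′≡x = inj x′ x (S⊆E x′∈S) x∈E (≡.trans ψx′≡y (≡.sym ψx≡y))
      in proj₂ (x∈p─q⁻ x∈) (≡.subst (_∈ S) x′≡x x′∈S)

image-injective : ∀ {ψ : Fin m → Fin n} {E S₁ S₂} → InjectiveOn ψ E → S₁ ⊆ E → S₂ ⊆ E →
                  image ψ S₁ ≡ image ψ S₂ → S₁ ≡ S₂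
image-injective {ψ = ψ} {E} inj S₁⊆E S₂⊆E ψS₁≡ψS₂ =
  ⊆-antisym (reflect S₁⊆E S₂⊆E ψS₁≡ψS₂) (reflect S₂⊆E S₁⊆E (≡.sym ψS₁≡ψS₂))
  where
  reflect : ∀ {S S′} → S ⊆ E → S′ ⊆ E → image ψ S ≡ image ψ S′ → S ⊆ S′
  reflect {S} {S′} S⊆E S′⊆E ψS≡ψS′ {x} x∈S =
    let ψx∈ψS′ = ≡.subst (ψ x ∈_) ψS≡ψS′ (from (isImage-image ψ S (ψ x)) (x , x∈S , refl))
        x′ , x′∈S′ , ψx′≡ψx = to (isImage-image ψ S′ (ψ x)) ψx∈ψS′
    in ≡.subst (_∈ S′) (inj x′ x (S′⊆E x′∈S′) (S⊆E x∈S) ψx′≡ψx) x′∈S′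

image-surjective : ∀ {ψ : Fin m → Fin n} {E E′ S′} → IsImage ψ E E′ → S′ ⊆ E′ →
                   ∃[ S ] (S ⊆ E × image ψ S ≡ S′)
image-surjective {ψ = ψ} {E} {E′} {S′} E′-img S′⊆E′ =
  E ∩ preimage ψ S′ , p∩q⊆p E _ , isImage-unique (isImage-image ψ _) S′-img
  where
  S′-img : IsImage ψ (E ∩ preimage ψ S′) S′
  S′-img y = mk⇔
    (λ y∈S′ → let x , x∈E , ψx≡y = to (E′-img y) (S′⊆E′ y∈S′)
              in x , x∈p∩q⁺ (x∈E , from ∈-preimage⇔ (≡.subst (_∈ S′) (≡.sym ψx≡y) y∈S′)) , ψx≡y)
    (λ { (x , x∈ , refl) → to ∈-preimage⇔ (proj₂ (x∈p∩q⁻ E _ x∈)) })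

subsetsOf-image : ∀ {ψ : Fin m → Fin n} {E E′} → InjectiveOn ψ E → IsImage ψ E E′ →
                  map (image ψ) (subsetsOf E) ↭ subsetsOf E′
subsetsOf-image {ψ = ψ} {E} {E′} inj E′-img = map-↭ (subsetsOf-unique E) (subsetsOf-unique E′)
  (λ S₁∈ S₂∈ → image-injective inj (∈-subsetsOf⁻ S₁∈) (∈-subsetsOf⁻ S₂∈))
  (mk⇔
    (λ S′∈ → let S , S⊆E , ψS≡S′ = image-surjective E′-img (∈-subsetsOf⁻ S′∈) in S , ∈-subsetsOf⁺ S⊆E , ψS≡S′)
    (λ { (S , S∈ , refl) → ∈-subsetsOf⁺ (isImage-mono (isImage-image ψ S) E′-img (∈-subsetsOf⁻ S∈)) }))

elements-image : ∀ {ψ : Fin m → Fin n} {A A′} → InjectiveOn ψ A → IsImage ψ A A′ →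
                 map ψ (elements A) ↭ elements A′
elements-image {A = A} {A′} inj A′-img = map-↭ (elements-unique A) (elements-unique A′)
  (λ x∈ y∈ → inj _ _ (to ∈-elements⇔ x∈) (to ∈-elements⇔ y∈))
  (λ {y} → mk⇔
    (λ y∈ → let x , x∈ , eq = to (A′-img y) (to ∈-elements⇔ y∈) in x , from ∈-elements⇔ x∈ , eq)
    (λ { (x , x∈ , eq) → from ∈-elements⇔ (from (A′-img y) (x , to ∈-elements⇔ x∈ , eq)) }))

∏-image : ∀ {ψ : Fin m → Fin n} {A A′} f → InjectiveOn ψ A → IsImage ψ A A′ →
          ∏ (elements A′) f ≡ ∏ (elements A) (f ∘ ψ)
∏-image {ψ = ψ} {A} f inj A′-img =
  ≡.trans (∏-↭ f (↭-sym (elements-image inj A′-img))) (∏-map ψ (elements A) f)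

-- Inversion signs

_<ᶠ_ : Fin n → Fin n → Bool
x <ᶠ y = toℕ x <ᵇ toℕ y

<ᵇ-flip : ∀ {i j} → i ≢ j → (j <ᵇ i) ≡ not (i <ᵇ j)
<ᵇ-flip {i} {j} i≢j with i <ᵇ j | <ᵇ-reflects-< i j | j <ᵇ i | <ᵇ-reflects-< j i
... | true  | ofʸ i<j | true  | ofʸ j<i = ⊥-elim (<-asym i<j j<i)
... | true  | _       | false | _       = refl
... | false | _       | true  | _       = refl
... | false | ofⁿ i≮j | false | ofⁿ j≮i = ⊥-elim (i≢j (≤-antisym (≮⇒≥ j≮i) (≮⇒≥ i≮j)))

<ᵇ-asym : ∀ i j → ((i <ᵇ j) ∧ (j <ᵇ i)) ≡ false
<ᵇ-asym i j with i <ᵇ j | <ᵇ-reflects-< i j | j <ᵇ i | <ᵇ-reflects-< j i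
... | true  | ofʸ i<j | true  | ofʸ j<i = ⊥-elim (<-asym i<j j<i)
... | true  | _       | false | _       = refl
... | false | _       | _     | _       = refl

<ᶠ-flip : ∀ {x y : Fin n} → x ≢ y → y <ᶠ x ≡ not (x <ᶠ y)
<ᶠ-flip x≢y = <ᵇ-flip (x≢y ∘ toℕ-injective)

∏∏ : Subset n → Subset n → (Fin n → Fin n → Sign) → Sign
∏∏ A B k = ∏ (elements A) λ x → ∏ (elements B) (k x)

sgn-∧ : ∀ a b → sgn (a ∧ b) ≡ (if a then sgn b else ⊕)
sgn-∧ true  b = refl
sgn-∧ false b = refl

parity-countPairs-∏∏ : ∀ (A B : Subset n) (R : Fin n → Fin n → Bool) {P} →
  (∀ x y → P x y ≡ lookup A x ∧ (lookup B y ∧ R x y)) →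
  parity (countPairs n P) ≡ ∏∏ A B (λ x y → sgn (R x y))
parity-countPairs-∏∏ {n} A B R {P} P≗ = begin
  parity (countPairs n P)                                  ≡⟨ parity-countPairs n P ⟩
  ∏ (allFin n) (λ x → ∏ (allFin n) (λ y → sgn (P x y)))    ≡⟨ ∏-cong (allFin n) row ⟩
  ∏ (allFin n) (λ x → if lookup A x then column x else ⊕)  ≡⟨ ∏-elements A column ⟨
  ∏∏ A B (λ x y → sgn (R x y))                             ∎
  where
  open ≡-Reasoning
  column : Fin n → Sign
  column x = ∏ (elements B) (λ y → sgn (R x y))
  row : ∀ x → ∏ (allFin n) (λ y → sgn (P x y)) ≡ (if lookup A x then column x else ⊕)
  row x = ≡.trans (∏-cong (allFin n) λ y → ≡.trans (cong sgn (P≗ x y)) (sgn-∧ (lookup A x) _))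
                  (by-cases (lookup A x))
    where
    by-cases : ∀ a → ∏ (allFin n) (λ y → if a then sgn (lookup B y ∧ R x y) else ⊕)
                   ≡ (if a then column x else ⊕)
    by-cases true  = ≡.trans (∏-cong (allFin n) λ y → sgn-∧ (lookup B y) (R x y)) (≡.sym (∏-elements B _))
    by-cases false = ∏-⊕ (allFin n)

mapSign-∏∏ : ∀ (ψ : Fin m → Fin n) E → mapSign ψ E ≡ ∏∏ E E (λ x y → sgn ((x <ᶠ y) ∧ (ψ y <ᶠ ψ x)))
mapSign-∏∏ ψ E = parity-countPairs-∏∏ E E _ λ _ _ → refl

shuffleSign-∏∏ : ∀ (E S : Subset n) → shuffleSign E S ≡ ∏∏ S (E ─ S) (λ x y → sgn (y <ᶠ x))
shuffleSign-∏∏ E S = parity-countPairs-∏∏ S (E ─ S) _ λ x y → cong (lookup S x ∧_)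
  (≡.trans (≡.sym (∧-assoc (lookup E y) _ _)) (cong (_∧ (y <ᶠ x)) (≡.sym (lookup-─ E S y))))

∏∏-cong : ∀ {A B : Subset n} {k k′} → (∀ x y → x ∈ A → y ∈ B → k x y ≡ k′ x y) → ∏∏ A B k ≡ ∏∏ A B k′
∏∏-cong {A = A} {B} k≗k′ = ∏-cong-∈ (elements A) λ x x∈ → ∏-cong-∈ (elements B) λ y y∈ →
  k≗k′ x y (to ∈-elements⇔ x∈) (to ∈-elements⇔ y∈)

∏∏-* : ∀ (A B : Subset n) k k′ → ∏∏ A B (λ x y → k x y *ₛ k′ x y) ≡ ∏∏ A B k *ₛ ∏∏ A B k′
∏∏-* A B k k′ = ≡.trans (∏-cong (elements A) λ x → ∏-* (elements B) (k x) (k′ x))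
  (∏-* (elements A) (λ x → ∏ (elements B) (k x)) (λ x → ∏ (elements B) (k′ x)))

∏∏-transpose : ∀ (A B : Subset n) k → ∏∏ B A k ≡ ∏∏ A B (λ x y → k y x)
∏∏-transpose A B k = ∏-comm (elements B) (elements A) k

∏∏-splitˡ : ∀ {A A′ : Subset n} B k → A′ ⊆ A → ∏∏ A B k ≡ ∏∏ A′ B k *ₛ ∏∏ (A ─ A′) B k
∏∏-splitˡ B k A′⊆A = ∏-elements-split (λ x → ∏ (elements B) (k x)) A′⊆A

∏∏-splitʳ : ∀ (A : Subset n) {B B′} k → B′ ⊆ B → ∏∏ A B k ≡ ∏∏ A B′ k *ₛ ∏∏ A (B ─ B′) k
∏∏-splitʳ A {B} {B′} k B′⊆B = ≡.trans (∏-cong (elements A) λ x → ∏-elements-split (k x) B′⊆B)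
  (∏-* (elements A) (λ x → ∏ (elements B′) (k x)) (λ x → ∏ (elements (B ─ B′)) (k x)))

mapSign-id : ∀ (E : Subset n) → mapSign (λ x → x) E ≡ ⊕
mapSign-id E = begin
  mapSign (λ x → x) E
    ≡⟨ mapSign-∏∏ (λ x → x) E ⟩
  ∏∏ E E (λ x y → sgn ((x <ᶠ y) ∧ (y <ᶠ x)))
    ≡⟨ ∏∏-cong {A = E} {E} (λ x y _ _ → cong sgn (<ᵇ-asym (toℕ x) (toℕ y))) ⟩
  ∏ (elements E) (λ x → ∏ (elements E) (λ _ → ⊕))
    ≡⟨ ∏-cong (elements E) (λ _ → ∏-⊕ (elements E)) ⟩
  ∏ (elements E) (λ _ → ⊕)
    ≡⟨ ∏-⊕ (elements E) ⟩
  ⊕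
    ∎
  where open ≡-Reasoning

mapSign-Empty : ∀ (ψ : Fin m → Fin n) {E} → Empty E → mapSign ψ E ≡ ⊕
mapSign-Empty ψ {E} E-empty = ≡.trans (mapSign-∏∏ ψ E)
  (∏-elements-Empty (λ x → ∏ (elements E) (λ y → sgn ((x <ᶠ y) ∧ (ψ y <ᶠ ψ x)))) E-empty)

shuffleSign-⊥ : ∀ (E : Subset n) → shuffleSign E ⊥ ≡ ⊕
shuffleSign-⊥ E = ≡.trans (shuffleSign-∏∏ E ⊥)
  (∏-elements-Empty (λ x → ∏ (elements (E ─ ⊥)) (λ y → sgn (y <ᶠ x))) Empty-⊥)

shuffleSign-self : ∀ (E : Subset n) → shuffleSign E E ≡ ⊕
shuffleSign-self E = begin
  shuffleSign E E
    ≡⟨ shuffleSign-∏∏ E E ⟩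
  ∏∏ E (E ─ E) (λ x y → sgn (y <ᶠ x))
    ≡⟨ ∏-cong (elements E) (λ x → ∏-elements-Empty (λ y → sgn (y <ᶠ x)) (Empty-─-self E)) ⟩
  ∏ (elements E) (λ _ → ⊕)
    ≡⟨ ∏-⊕ (elements E) ⟩
  ⊕
    ∎
  where open ≡-Reasoning

shuffleSign-trans : ∀ {E S T : Subset n} → S ⊆ E → T ⊆ S →
  shuffleSign S T *ₛ shuffleSign E S ≡ shuffleSign E T *ₛ shuffleSign (E ─ T) (S ─ T)
shuffleSign-trans {n} {E} {S} {T} S⊆E T⊆S = begin
  shuffleSign S T *ₛ shuffleSign E S
    ≡⟨ cong₂ _*ₛ_ (shuffleSign-∏∏ S T) (shuffleSign-∏∏ E S) ⟩
  ∏∏ T U c *ₛ ∏∏ S V c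
    ≡⟨ cong (∏∏ T U c *ₛ_) (∏∏-splitˡ V c T⊆S) ⟩
  ∏∏ T U c *ₛ (∏∏ T V c *ₛ ∏∏ U V c)
    ≡⟨ *-assoc (∏∏ T U c) _ _ ⟨
  (∏∏ T U c *ₛ ∏∏ T V c) *ₛ ∏∏ U V c
    ≡⟨ cong (λ W → (∏∏ T U c *ₛ ∏∏ T W c) *ₛ ∏∏ U W c) (─-─-⊆ {E = E} T⊆S) ⟨
  (∏∏ T U c *ₛ ∏∏ T W c) *ₛ ∏∏ U W c
    ≡⟨ cong (_*ₛ ∏∏ U W c) (∏∏-splitʳ T {E ─ T} c (─-monoˡ S⊆E)) ⟨
  ∏∏ T (E ─ T) c *ₛ ∏∏ U W c
    ≡⟨ cong₂ _*ₛ_ (shuffleSign-∏∏ E T) (shuffleSign-∏∏ (E ─ T) U) ⟨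
  shuffleSign E T *ₛ shuffleSign (E ─ T) U
    ∎
  where
  open ≡-Reasoning
  U = S ─ T
  V = E ─ S
  W = (E ─ T) ─ U
  c : Fin n → Fin n → Sign
  c x y = sgn (y <ᶠ x)

-- Read x′, y′ as ψ x, ψ y: of (x , y) and (y , x), exactly one is an inversion of ψ if ψ reverses
-- the order of x and y, and neither is otherwise.
inversion-pair : ∀ {x y : Fin m} {x′ y′ : Fin n} → x ≢ y → x′ ≢ y′ →
  sgn ((x <ᶠ y) ∧ (y′ <ᶠ x′)) *ₛ sgn ((y <ᶠ x) ∧ (x′ <ᶠ y′)) ≡ sgn (y <ᶠ x) *ₛ sgn (y′ <ᶠ x′)
inversion-pair {x = x} {y} {x′} {y′} x≢y x′≢y′ rewrite <ᶠ-flip x≢y | <ᶠ-flip x′≢y′ =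
  by-cases (x <ᶠ y) (x′ <ᶠ y′)
  where
  by-cases : ∀ a b → sgn (a ∧ not b) *ₛ sgn (not a ∧ b) ≡ sgn (not a) *ₛ sgn (not b)
  by-cases true  true  = refl
  by-cases true  false = refl
  by-cases false true  = refl
  by-cases false false = refl

mapSign-─ : ∀ (ψ : Fin m → Fin n) {E S} → InjectiveOn ψ E → S ⊆ E →
  mapSign ψ E ≡ (mapSign ψ S *ₛ mapSign ψ (E ─ S))
                  *ₛ (shuffleSign E S *ₛ ∏∏ S (E ─ S) (λ x y → sgn (ψ y <ᶠ ψ x)))
mapSign-─ {m} ψ {E} {S} inj S⊆E = begin
  mapSign ψ E
    ≡⟨ mapSign-∏∏ ψ E ⟩
  ∏∏ E E inv
    ≡⟨ ∏∏-splitˡ E inv S⊆E ⟩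
  ∏∏ S E inv *ₛ ∏∏ V E inv
    ≡⟨ cong₂ _*ₛ_ (∏∏-splitʳ S inv S⊆E) (∏∏-splitʳ V inv S⊆E) ⟩
  (∏∏ S S inv *ₛ X) *ₛ (Xᵀ *ₛ ∏∏ V V inv)
    ≡⟨ cong₂ (λ s t → (s *ₛ X) *ₛ (Xᵀ *ₛ t)) (mapSign-∏∏ ψ S) (mapSign-∏∏ ψ V) ⟨
  (mapSign ψ S *ₛ X) *ₛ (Xᵀ *ₛ mapSign ψ V)
    ≡⟨ cong ((mapSign ψ S *ₛ X) *ₛ_) (*-comm Xᵀ (mapSign ψ V)) ⟩
  (mapSign ψ S *ₛ X) *ₛ (mapSign ψ V *ₛ Xᵀ)
    ≡⟨ interchange (mapSign ψ S) X (mapSign ψ V) Xᵀ ⟩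
  (mapSign ψ S *ₛ mapSign ψ V) *ₛ (X *ₛ Xᵀ)
    ≡⟨ cong ((mapSign ψ S *ₛ mapSign ψ V) *ₛ_) crossing ⟩
  (mapSign ψ S *ₛ mapSign ψ V) *ₛ (shuffleSign E S *ₛ ∏∏ S V c′)
    ∎
  where
  open ≡-Reasoning
  V = E ─ S
  inv c c′ : Fin m → Fin m → Sign
  inv x y = sgn ((x <ᶠ y) ∧ (ψ y <ᶠ ψ x))
  c   x y = sgn (y <ᶠ x)
  c′  x y = sgn (ψ y <ᶠ ψ x)
  X Xᵀ : Sign
  X  = ∏∏ S V inv
  Xᵀ = ∏∏ V S inv
  crossing-pair : ∀ x y → x ∈ S → y ∈ V → inv x y *ₛ inv y x ≡ c x y *ₛ c′ x y
  crossing-pair x y x∈S y∈V = inversion-pair x≢y (x≢y ∘ inj x y (S⊆E x∈S) y∈E)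
    where
    y∈E = proj₁ (x∈p─q⁻ y∈V)
    x≢y : x ≢ y
    x≢y x≡y = proj₂ (x∈p─q⁻ y∈V) (≡.subst (_∈ S) x≡y x∈S)
  crossing : X *ₛ Xᵀ ≡ shuffleSign E S *ₛ ∏∏ S V c′
  crossing = begin
    X *ₛ Xᵀ                                  ≡⟨ cong (X *ₛ_) (∏∏-transpose S V inv) ⟩
    ∏∏ S V inv *ₛ ∏∏ S V (λ x y → inv y x)   ≡⟨ ∏∏-* S V inv (λ x y → inv y x) ⟨
    ∏∏ S V (λ x y → inv x y *ₛ inv y x)      ≡⟨ ∏∏-cong crossing-pair ⟩
    ∏∏ S V (λ x y → c x y *ₛ c′ x y)         ≡⟨ ∏∏-* S V c c′ ⟩
    ∏∏ S V c *ₛ ∏∏ S V c′                    ≡⟨ cong (_*ₛ ∏∏ S V c′) (shuffleSign-∏∏ E S) ⟨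
    shuffleSign E S *ₛ ∏∏ S V c′             ∎

shuffleSign-image : ∀ (ψ : Fin m → Fin n) {E E′ S} → InjectiveOn ψ E → IsImage ψ E E′ → S ⊆ E →
  shuffleSign E′ (image ψ S) ≡ ∏∏ S (E ─ S) (λ x y → sgn (ψ y <ᶠ ψ x))
shuffleSign-image ψ {E} {E′} {S} inj E′-img S⊆E = begin
  shuffleSign E′ (image ψ S)
    ≡⟨ shuffleSign-∏∏ E′ (image ψ S) ⟩
  ∏ (elements (image ψ S)) (λ x′ → ∏ (elements (E′ ─ image ψ S)) (c x′))
    ≡⟨ ∏-image (λ x′ → ∏ (elements (E′ ─ image ψ S)) (c x′)) (injectiveOn-⊆ S⊆E inj) S′-img ⟩
  ∏ (elements S) (λ x → ∏ (elements (E′ ─ image ψ S)) (c (ψ x)))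
    ≡⟨ ∏-cong (elements S) (λ x → ∏-image (c (ψ x)) (injectiveOn-⊆ (p─q⊆p E S) inj)
                                          (isImage-─ inj E′-img S⊆E S′-img)) ⟩
  ∏∏ S (E ─ S) (λ x y → c (ψ x) (ψ y))
    ∎
  where
  open ≡-Reasoning
  S′-img = isImage-image ψ S
  c : _ → _ → Sign
  c x′ y′ = sgn (y′ <ᶠ x′)

mapSign-shuffleSign : ∀ (ψ : Fin m → Fin n) {E E′ S} → InjectiveOn ψ E → IsImage ψ E E′ → S ⊆ E →
  mapSign ψ S *ₛ (mapSign ψ (E ─ S) *ₛ shuffleSign E S) ≡ mapSign ψ E *ₛ shuffleSign E′ (image ψ S)
mapSign-shuffleSign ψ {E} {E′} {S} inj E′-img S⊆E = begin
  mS *ₛ (mV *ₛ sh)                          ≡⟨ *-assoc mS mV sh ⟨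
  (mS *ₛ mV) *ₛ sh                          ≡⟨ cong ((mS *ₛ mV) *ₛ_) (*-identityʳ sh) ⟨
  (mS *ₛ mV) *ₛ (sh *ₛ ⊕)                   ≡⟨ cong (λ s → (mS *ₛ mV) *ₛ (sh *ₛ s)) (s*s≡+ sh′) ⟨
  (mS *ₛ mV) *ₛ (sh *ₛ (sh′ *ₛ sh′))        ≡⟨ cong ((mS *ₛ mV) *ₛ_) (*-assoc sh sh′ sh′) ⟨
  (mS *ₛ mV) *ₛ ((sh *ₛ sh′) *ₛ sh′)        ≡⟨ *-assoc (mS *ₛ mV) _ sh′ ⟨
  ((mS *ₛ mV) *ₛ (sh *ₛ sh′)) *ₛ sh′        ≡⟨ cong (_*ₛ sh′) (mapSign-─ ψ inj S⊆E) ⟨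
  mapSign ψ E *ₛ sh′                        ≡⟨ cong (mapSign ψ E *ₛ_) (shuffleSign-image ψ inj E′-img S⊆E) ⟨
  mapSign ψ E *ₛ shuffleSign E′ (image ψ S) ∎
  where
  open ≡-Reasoning
  mS = mapSign ψ S
  mV = mapSign ψ (E ─ S)
  sh = shuffleSign E S
  sh′ = ∏∏ S (E ─ S) (λ x y → sgn (ψ y <ᶠ ψ x))

-- Linear combinations

Cong-setoid : GenRel A → Setoid _ _
Cong-setoid {A} G = record
  { Carrier       = Lin A
  ; _≈_           = Cong G
  ; isEquivalence = record { refl = c-refl ; sym = c-sym ; trans = c-trans }
  }

module CongReasoning {A : Set} (G : GenRel A) = SetoidReasoning (Cong-setoid G)

module _ {G : GenRel A} where

  ≡⇒Cong : ∀ {xs ys} → xs ≡ ys → Cong G xs ys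
  ≡⇒Cong refl = c-refl

  coefficient-Cong : ∀ {q r a} → q ≡ r → Cong G ((q , a) ∷ []) ((r , a) ∷ [])
  coefficient-Cong q≡r = ≡⇒Cong (cong (λ t → (t , _) ∷ []) q≡r)

  zero-Cong : ∀ {q a} → q ≡ 0ℚ → Cong G ((q , a) ∷ []) []
  zero-Cong q≡0 = c-trans (coefficient-Cong q≡0) c-zero

  ↭⇒Cong : ∀ {xs ys} → xs ↭ ys → Cong G xs ys
  ↭⇒Cong refl         = c-refl
  ↭⇒Cong (prep x p)   = c-++ {x = x ∷ []} c-refl (↭⇒Cong p)
  ↭⇒Cong (swap x y p) = c-++ {x = x ∷ y ∷ []} c-swap (↭⇒Cong p)
  ↭⇒Cong (trans p q)  = c-trans (↭⇒Cong p) (↭⇒Cong q)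

  map-Cong : ∀ {F H : B → ℚ × A} xs → (∀ x → x ∈L xs → Cong G (F x ∷ []) (H x ∷ [])) →
             Cong G (map F xs) (map H xs)
  map-Cong []       F≈H = c-refl
  map-Cong (x ∷ xs) F≈H = c-++ (F≈H x (here refl)) (map-Cong xs λ y y∈ → F≈H y (there y∈))

  map-Cong-[] : ∀ {F : B → ℚ × A} xs → (∀ x → x ∈L xs → Cong G (F x ∷ []) []) → Cong G (map F xs) []
  map-Cong-[] []       F≈0 = c-refl
  map-Cong-[] (x ∷ xs) F≈0 = c-++ {x = _ ∷ []} (F≈0 x (here refl)) (map-Cong-[] xs λ y y∈ → F≈0 y (there y∈))

  map-Cong-single : ∀ {F : B → ℚ × A} {xs z} → Unique xs → z ∈L xs →
                    (∀ x → x ∈L xs → x ≢ z → Cong G (F x ∷ []) []) → Cong G (map F xs) (F z ∷ [])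
  map-Cong-single {xs = x ∷ xs} (x∉xs ∷ _) (here refl) F≈0 =
    c-++ {x = _ ∷ []} c-refl (map-Cong-[] xs λ y y∈ → F≈0 y (there y∈) λ y≡x → All.lookup x∉xs y∈ (≡.sym y≡x))
  map-Cong-single {xs = x ∷ xs} (x∉xs ∷ xs!) (there z∈) F≈0 =
    c-++ {x = _ ∷ []} {x' = []} (F≈0 x (here refl) λ { refl → All.lookup x∉xs z∈ refl })
      (map-Cong-single xs! z∈ λ y y∈ → F≈0 y (there y∈))

  scale-+ : ∀ q r (L : Lin A) → Cong G (scale q L ++ scale r L) (scale (q + r) L)
  scale-+ q r []            = c-refl
  scale-+ q r ((c , a) ∷ L) = c-trans
    (↭⇒Cong (prep (q * c , a) (shift (r * c , a) (scale q L) (scale r L))))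
    (c-++ {x = (q * c , a) ∷ (r * c , a) ∷ []}
      (c-trans c-merge (coefficient-Cong (≡.sym (*-distribʳ-+ c q r))))
      (scale-+ q r L))

  scale-0 : ∀ (L : Lin A) → Cong G (scale 0ℚ L) []
  scale-0 []            = c-refl
  scale-0 ((c , a) ∷ L) = c-++ {x = (0ℚ * c , a) ∷ []} (zero-Cong (*-zeroˡ c)) (scale-0 L)

_⊗ₗ_ : A → Lin B → Lin (A × B)
a ⊗ₗ xs = map (λ (q , b) → q , (a , b)) xs

⊗-congˡ : ∀ {G₁ : GenRel A} {G₂ : GenRel B} a {xs ys} →
          Cong G₂ xs ys → Cong (GenT G₁ G₂) (a ⊗ₗ xs) (a ⊗ₗ ys)
⊗-congˡ a c-refl                         = c-refl
⊗-congˡ a (c-sym p)                      = c-sym (⊗-congˡ a p)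
⊗-congˡ a (c-trans p q)                  = c-trans (⊗-congˡ a p) (⊗-congˡ a q)
⊗-congˡ a (c-++ {x} {x'} {y} {y'} p q) = c-trans (≡⇒Cong (map-++ _ x y))
  (c-trans (c-++ (⊗-congˡ a p) (⊗-congˡ a q)) (≡⇒Cong (≡.sym (map-++ _ x' y'))))
⊗-congˡ a c-swap                         = c-swap
⊗-congˡ a c-merge                        = c-merge
⊗-congˡ a c-zero                         = c-zero
⊗-congˡ a (c-gen g)                      = c-gen (gen-r g)

*-≡-cases : ∀ {a b c d} → a *ₛ b ≡ c *ₛ d → (c ≡ a × d ≡ b) ⊎ (c ≡ opposite a × d ≡ opposite b)
*-≡-cases {⊕} {c = ⊕} ab≡cd = inj₁ (refl , ≡.sym ab≡cd)
*-≡-cases {⊖} {c = ⊖} ab≡cd = inj₁ (refl , ≡.sym (opposite-injective ab≡cd))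
*-≡-cases {⊕} {c = ⊖} ab≡cd = inj₂ (refl , ≡.trans (≡.sym (opposite-involutive _)) (cong opposite (≡.sym ab≡cd)))
*-≡-cases {⊖} {c = ⊕} ab≡cd = inj₂ (refl , ≡.sym ab≡cd)

flip-pair : ∀ q (a b : Sym) → ((q , (flipO a , flipO b)) ∷ []) ≈MM ((q , (a , b)) ∷ [])
flip-pair q a b = begin
  (q , (flipO a , flipO b)) ∷ []  ≈⟨ c-gen (gen-l (gen-neg q a)) ⟩
  (- q , (a , flipO b)) ∷ []      ≈⟨ c-gen (gen-r (gen-neg (- q) b)) ⟩
  (- - q , (a , b)) ∷ []          ≈⟨ coefficient-Cong (⁻¹-involutive q) ⟩
  (q , (a , b)) ∷ []              ∎
  where open CongReasoning (GenT GenM GenM)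

reorient-pair : ∀ {n E r n′ E′ r′} q {a b c d} → a *ₛ b ≡ c *ₛ d →
  ((q , (sym n E r a , sym n′ E′ r′ b)) ∷ []) ≈MM ((q , (sym n E r c , sym n′ E′ r′ d)) ∷ [])
reorient-pair q {a} {b} {c} {d} ab≡cd with *-≡-cases {a} {b} {c} {d} ab≡cd
... | inj₁ (refl , refl) = c-refl
... | inj₂ (refl , refl) = c-sym (flip-pair q _ _)

-- Isomorphisms of symbols

mkIso : ∀ {g h} (ψ : Fin (amb g) → Fin (amb h)) → InjectiveOn ψ (ground g) → IsImage ψ (ground g) (ground h) →
        (∀ X Y → X ⊆ ground g → Y ⊆ ground h → IsImage ψ X Y → rank h Y ≡ rank g X) →
        orient h ≡ mapSign ψ (ground g) *ₛ orient g → Iso g h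
mkIso ψ inj E′-img rank-ψ orient-ψ = record
  { ψ        = ψ
  ; into     = λ x x∈ → from (E′-img (ψ x)) (x , x∈ , refl)
  ; inj      = inj
  ; onto     = λ y → to (E′-img y)
  ; rank-ψ   = rank-ψ
  ; orient-ψ = orient-ψ
  }

Iso-isImage : ∀ {g h} (I : Iso g h) → IsImage (Iso.ψ I) (ground g) (ground h)
Iso-isImage I y = mk⇔ (Iso.onto I y) λ { (x , x∈ , refl) → Iso.into I x x∈ }

Iso-id : ∀ {n E E′ r r′ s s′} → E ≡ E′ → s′ ≡ s → (∀ X → X ⊆ E → r′ X ≡ r X) →
         Iso (sym n E r s) (sym n E′ r′ s′)
Iso-id {E = E} {r′ = r′} {s} refl s′≡s r′≗r = mkIso (λ x → x)
  (λ _ _ _ _ x≡y → x≡y)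
  (λ y → mk⇔ (λ y∈ → y , y∈ , refl) λ { (x , x∈ , refl) → x∈ })
  (λ X Y X⊆E _ Y-img → ≡.trans (cong r′ (isImage-id Y-img)) (r′≗r X X⊆E))
  (≡.trans s′≡s (cong (_*ₛ s) (≡.sym (mapSign-id E))))

module _ {g h : Sym} (I : Iso g h) {S : Subset (amb g)} (S⊆E : S ⊆ ground g) where

  private
    ψ = Iso.ψ I
    S′-img = isImage-image ψ S
    S′⊆E′ = isImage-mono S′-img (Iso-isImage I) S⊆E

  Iso-restrict : ∀ a → Iso (restrict g S a) (restrict h (image ψ S) (mapSign ψ S *ₛ a))
  Iso-restrict a = mkIso ψ (injectiveOn-⊆ S⊆E (Iso.inj I)) S′-img
    (λ X Y X⊆S Y⊆S′ → Iso.rank-ψ I X Y (⊆-trans X⊆S S⊆E) (⊆-trans Y⊆S′ S′⊆E′))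
    refl

  Iso-contract : ∀ b → Iso (contract g S b) (contract h (image ψ S) (mapSign ψ (ground g ─ S) *ₛ b))
  Iso-contract b = mkIso ψ (injectiveOn-⊆ (p─q⊆p (ground g) S) (Iso.inj I))
    (isImage-─ (Iso.inj I) (Iso-isImage I) S⊆E S′-img)
    (λ X Y X⊆E─S Y⊆E′─S′ Y-img → cong₂ _∸_
      (Iso.rank-ψ I (X ∪ S) (Y ∪ image ψ S) (∪-⊆ (⊆-trans X⊆E─S (p─q⊆p _ _)) S⊆E)
                  (∪-⊆ (⊆-trans Y⊆E′─S′ (p─q⊆p _ _)) S′⊆E′) (isImage-∪ Y-img S′-img))
      (Iso.rank-ψ I S (image ψ S) S⊆E S′⊆E′ S′-img))
    refl

  Iso-orient-split : mapSign ψ S *ₛ (mapSign ψ (ground g ─ S) *ₛ (orient g *ₛ shuffleSign (ground g) S))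
                       ≡ orient h *ₛ shuffleSign (ground h) (image ψ S)
  Iso-orient-split = begin
    mS *ₛ (mV *ₛ (o *ₛ sh))
      ≡⟨ cong (mS *ₛ_) (x∙yz≈y∙xz mV o sh) ⟩
    mS *ₛ (o *ₛ (mV *ₛ sh))
      ≡⟨ x∙yz≈y∙xz mS o (mV *ₛ sh) ⟩
    o *ₛ (mS *ₛ (mV *ₛ sh))
      ≡⟨ cong (o *ₛ_) (mapSign-shuffleSign ψ (Iso.inj I) (Iso-isImage I) S⊆E) ⟩
    o *ₛ (mapSign ψ (ground g) *ₛ sh′)
      ≡⟨ xy∙z≈y∙xz (mapSign ψ (ground g)) o sh′ ⟨
    (mapSign ψ (ground g) *ₛ o) *ₛ sh′
      ≡⟨ cong (_*ₛ sh′) (Iso.orient-ψ I) ⟨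
    orient h *ₛ sh′
      ∎
    where
    open ≡-Reasoning
    mS = mapSign ψ S
    mV = mapSign ψ (ground g ─ S)
    o = orient g
    sh = shuffleSign (ground g) S
    sh′ = shuffleSign (ground h) (image ψ S)

contract-contract : ∀ g {S T} c b → IsMatroidSym g → S ⊆ ground g → T ⊆ S →
                    Iso (contract g S b) (contract (contract g T c) (S ─ T) b)
contract-contract (sym _ E r _) {S} {T} _ _ M S⊆E T⊆S = Iso-id (≡.sym (─-─-⊆ T⊆S)) refl λ X _ → begin
  (r ((X ∪ (S ─ T)) ∪ T) ∸ r T) ∸ (r ((S ─ T) ∪ T) ∸ r T)
    ≡⟨ cong₂ (λ A B → (r A ∸ r T) ∸ (r B ∸ r T)) (∪-─-∪ X) S─T∪T ⟩
  (r (X ∪ S) ∸ r T) ∸ (r S ∸ r T)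
    ≡⟨ ∸-+-assoc (r (X ∪ S)) (r T) (r S ∸ r T) ⟩
  r (X ∪ S) ∸ (r T +ℕ (r S ∸ r T))
    ≡⟨ cong (r (X ∪ S) ∸_) (m+[n∸m]≡n (IsMatroid.rk-mono M T S (⊆-trans T⊆S S⊆E) S⊆E T⊆S)) ⟩
  r (X ∪ S) ∸ r S
    ∎
  where
  open ≡-Reasoning
  S─T∪T : (S ─ T) ∪ T ≡ S
  S─T∪T = ≡.trans (∪-comm (S ─ T) T) (∪-─-⊆ T⊆S)
  ∪-─-∪ : ∀ X → (X ∪ (S ─ T)) ∪ T ≡ X ∪ S
  ∪-─-∪ X = ≡.trans (∪-assoc X (S ─ T) T) (cong (X ∪_) S─T∪T)

-- The counit

Nonempty⇒isZero≡false : ∀ {p : Subset n} → Nonempty p → isZero ∣ p ∣ ≡ false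
Nonempty⇒isZero≡false {p = p} (x , x∈p) with ∣ p ∣ | x∈p⇒∣p-x∣<∣p∣ x∈p
... | suc _ | _ = refl

ε-Nonempty : ∀ g → Nonempty (ground g) → ε g ≡ 0ℚ
ε-Nonempty g E-nonempty rewrite Nonempty⇒isZero≡false E-nonempty = refl

ε-Empty : ∀ g → Empty (ground g) → ε g ≡ signℚ (orient g)
ε-Empty g E-empty rewrite Empty-unique E-empty | ∣⊥∣≡0 (amb g) = refl

signℚ-opposite : ∀ s → signℚ (opposite s) ≡ - signℚ s
signℚ-opposite ⊕ = refl
signℚ-opposite ⊖ = refl

ε-flip : ∀ g → ε (flipO g) ≡ - ε g
ε-flip g with isZero ∣ ground g ∣
... | true  = signℚ-opposite (orient g)
... | false = refl

ε-iso : ∀ {g h} → Iso g h → ε g ≡ ε h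
ε-iso {g} {h} I with nonempty? (ground g)
... | yes (x , x∈E) = ≡.trans (ε-Nonempty g (x , x∈E)) (≡.sym (ε-Nonempty h (Iso.ψ I x , Iso.into I x x∈E)))
... | no E-empty    = begin
  ε g
    ≡⟨ ε-Empty g E-empty ⟩
  signℚ (orient g)
    ≡⟨ cong (λ s → signℚ (s *ₛ orient g)) (mapSign-Empty (Iso.ψ I) E-empty) ⟨
  signℚ (mapSign (Iso.ψ I) (ground g) *ₛ orient g)
    ≡⟨ cong signℚ (Iso.orient-ψ I) ⟨
  signℚ (orient h)
    ≡⟨ ε-Empty h E′-empty ⟨
  ε h
    ∎
  where
  open ≡-Reasoning
  E′-empty : Empty (ground h)
  E′-empty (y , y∈E′) = let x , x∈E , _ = Iso.onto I y y∈E′ in E-empty (x , x∈E)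

ε̂-++ : ∀ x y → ε̂ (x ++ y) ≡ ε̂ x + ε̂ y
ε̂-++ []            y = ≡.sym (+-identityˡ (ε̂ y))
ε̂-++ ((q , g) ∷ x) y = ≡.trans (cong (q * ε g +_) (ε̂-++ x y)) (≡.sym (+-assoc (q * ε g) (ε̂ x) (ε̂ y)))

ε̂-resp : ∀ {x y} → x ≈M y → ε̂ x ≡ ε̂ y
ε̂-resp c-refl                         = refl
ε̂-resp (c-sym p)                      = ≡.sym (ε̂-resp p)
ε̂-resp (c-trans p q)                  = ≡.trans (ε̂-resp p) (ε̂-resp q)
ε̂-resp (c-++ {x} {x'} {y} {y'} p q) =
  ≡.trans (ε̂-++ x y) (≡.trans (cong₂ _+_ (ε̂-resp p) (ε̂-resp q)) (≡.sym (ε̂-++ x' y')))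
ε̂-resp (c-swap {q , a} {r , b})       = +-x∙yz≈y∙xz (q * ε a) (r * ε b) 0ℚ
ε̂-resp (c-merge {q} {r} {a})          = begin
  q * ε a + (r * ε a + 0ℚ)  ≡⟨ cong (q * ε a +_) (+-identityʳ (r * ε a)) ⟩
  q * ε a + r * ε a         ≡⟨ *-distribʳ-+ (ε a) q r ⟨
  (q + r) * ε a             ≡⟨ +-identityʳ _ ⟨
  (q + r) * ε a + 0ℚ        ∎
  where open ≡-Reasoning
ε̂-resp (c-zero {a})                   = cong (_+ 0ℚ) (*-zeroˡ (ε a))
ε̂-resp (c-gen (gen-neg q g))          = cong (_+ 0ℚ) (begin
  q * ε (flipO g)  ≡⟨ cong (q *_) (ε-flip g) ⟩
  q * - ε g        ≡⟨ neg-distribʳ-* q (ε g) ⟨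
  - (q * ε g)      ≡⟨ neg-distribˡ-* q (ε g) ⟩
  - q * ε g        ∎)
  where open ≡-Reasoning
ε̂-resp (c-gen (gen-iso q g h I))      = cong (λ t → q * t + 0ℚ) (ε-iso I)

rank-⊥ : ∀ {n E r} → IsMatroid n E r → r ⊥ ≡ 0
rank-⊥ {n} {r = r} M = n≤0⇒n≡0 (≡.subst (r ⊥ ≤_) (∣⊥∣≡0 n) (IsMatroid.rk-bound M ⊥ ⊥⊆))

signℚ-orient : ∀ {n E r} s → ((signℚ s , sym n E r ⊕) ∷ []) ≈M ((1ℚ , sym n E r s) ∷ [])
signℚ-orient ⊕ = c-refl
signℚ-orient ⊖ = c-sym (c-gen (gen-neg 1ℚ _))

ε-contract-ground : ∀ g →
  ε (contract g (ground g) (orient g *ₛ shuffleSign (ground g) (ground g))) ≡ signℚ (orient g)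
ε-contract-ground g@(sym _ E _ o) = begin
  ε (contract g E (o *ₛ shuffleSign E E))  ≡⟨ ε-Empty (contract g E (o *ₛ shuffleSign E E)) (Empty-─-self E) ⟩
  signℚ (o *ₛ shuffleSign E E)             ≡⟨ cong (λ s → signℚ (o *ₛ s)) (shuffleSign-self E) ⟩
  signℚ (o *ₛ ⊕)                           ≡⟨ cong signℚ (*-identityʳ o) ⟩
  signℚ o                                  ∎
  where open ≡-Reasoning

counitˡ : ∀ g → IsMatroidSym g → ε⊗id (Δ g) ≈M ((1ℚ , g) ∷ [])
counitˡ g@(sym n E r o) M = begin
  ε⊗id (Δ g)
    ≡⟨ map-∘ (subsetsOf E) ⟨
  map term (subsetsOf E)
    ≈⟨ map-Cong-single (subsetsOf-unique E) (∈-subsetsOf⁺ ⊥⊆) vanish ⟩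
  term ⊥ ∷ []
    ≈⟨ coefficient-Cong (cong (1ℚ *_) (ε-Empty (sym n ⊥ r ⊕) Empty-⊥)) ⟩
  (1ℚ , contract g ⊥ (o *ₛ shuffleSign E ⊥)) ∷ []
    ≈⟨ c-gen (gen-iso 1ℚ _ _ (Iso-id (p─⊥≡p E) orient-⊥ rank-/⊥)) ⟩
  (1ℚ , g) ∷ []
    ∎
  where
  open CongReasoning GenM
  term : Subset n → ℚ × Sym
  term S = 1ℚ * ε (sym n S r ⊕) , contract g S (o *ₛ shuffleSign E S)
  vanish : ∀ S → S ∈L subsetsOf E → S ≢ ⊥ → (term S ∷ []) ≈M []
  vanish S _ S≢⊥ = zero-Cong (≡.trans (cong (1ℚ *_) (ε-Nonempty (sym n S r ⊕) (≢⊥⇒Nonempty S≢⊥))) (*-zeroʳ 1ℚ))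
  orient-⊥ : o ≡ o *ₛ shuffleSign E ⊥
  orient-⊥ = ≡.sym (≡.trans (cong (o *ₛ_) (shuffleSign-⊥ E)) (*-identityʳ o))
  rank-/⊥ : ∀ X → X ⊆ E ─ ⊥ → r X ≡ r (X ∪ ⊥) ∸ r ⊥
  rank-/⊥ X _ rewrite ∪-identityʳ X | rank-⊥ M = refl

counitʳ : ∀ g → id⊗ε (Δ g) ≈M ((1ℚ , g) ∷ [])
counitʳ g@(sym n E r o) = begin
  id⊗ε (Δ g)                    ≡⟨ map-∘ (subsetsOf E) ⟨
  map term (subsetsOf E)        ≈⟨ map-Cong-single (subsetsOf-unique E) (∈-subsetsOf⁺ ⊆-refl) vanish ⟩
  term E ∷ []                   ≈⟨ coefficient-Cong (≡.trans (*-identityˡ _) (ε-contract-ground g)) ⟩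
  (signℚ o , sym n E r ⊕) ∷ []  ≈⟨ signℚ-orient o ⟩
  (1ℚ , g) ∷ []                 ∎
  where
  open CongReasoning GenM
  term : Subset n → ℚ × Sym
  term S = 1ℚ * ε (contract g S (o *ₛ shuffleSign E S)) , sym n S r ⊕
  vanish : ∀ S → S ∈L subsetsOf E → S ≢ E → (term S ∷ []) ≈M []
  vanish S S∈ S≢E = zero-Cong (≡.trans
    (cong (1ℚ *_) (ε-Nonempty (contract g S (o *ₛ shuffleSign E S)) (─-Nonempty (∈-subsetsOf⁻ S∈) S≢E)))
    (*-zeroʳ 1ℚ))

-- The coproduct

opposite-*ˡ : ∀ s t → opposite s *ₛ t ≡ opposite (s *ₛ t)
opposite-*ˡ ⊕ t = refl
opposite-*ˡ ⊖ t = ≡.sym (opposite-involutive t)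

Δ-flip : ∀ q g → scale q (Δ (flipO g)) ≈MM scale (- q) (Δ g)
Δ-flip q g@(sym n E _ o) = begin
  scale q (Δ (flipO g))           ≡⟨ map-∘ (subsetsOf E) ⟨
  map term-flipped (subsetsOf E)  ≈⟨ map-Cong (subsetsOf E) (λ S _ → flip-term S) ⟩
  map term (subsetsOf E)          ≡⟨ map-∘ (subsetsOf E) ⟩
  scale (- q) (Δ g)               ∎
  where
  open CongReasoning (GenT GenM GenM)
  term-flipped term : Subset n → ℚ × (Sym × Sym)
  term-flipped S = q * 1ℚ , (restrict g S ⊕ , contract g S (opposite o *ₛ shuffleSign E S))
  term         S = - q * 1ℚ , (restrict g S ⊕ , contract g S (o *ₛ shuffleSign E S))
  flip-term : ∀ S → (term-flipped S ∷ []) ≈MM (term S ∷ [])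
  flip-term S = begin
    term-flipped S ∷ []
      ≡⟨ cong (λ s → (q * 1ℚ , (restrict g S ⊕ , contract g S s)) ∷ []) (opposite-*ˡ o _) ⟩
    (q * 1ℚ , (restrict g S ⊕ , flipO (contract g S (o *ₛ shuffleSign E S)))) ∷ []
      ≈⟨ c-gen (gen-r (gen-neg (q * 1ℚ) _)) ⟩
    (- (q * 1ℚ) , (restrict g S ⊕ , contract g S (o *ₛ shuffleSign E S))) ∷ []
      ≈⟨ coefficient-Cong (neg-distribˡ-* q 1ℚ) ⟩
    term S ∷ []
      ∎

Δ-iso : ∀ q {g h} → Iso g h → scale q (Δ g) ≈MM scale q (Δ h)
Δ-iso q {g} {h} I = begin
  scale q (Δ g)
    ≡⟨ map-∘ (subsetsOf (ground g)) ⟨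
  map (term g) (subsetsOf (ground g))
    ≈⟨ map-Cong (subsetsOf (ground g)) (λ _ S∈ → term-iso (∈-subsetsOf⁻ S∈)) ⟩
  map (term h ∘ image ψ) (subsetsOf (ground g))
    ≡⟨ map-∘ (subsetsOf (ground g)) ⟩
  map (term h) (map (image ψ) (subsetsOf (ground g)))
    ≈⟨ ↭⇒Cong (map⁺ (term h) (subsetsOf-image (Iso.inj I) (Iso-isImage I))) ⟩
  map (term h) (subsetsOf (ground h))
    ≡⟨ map-∘ (subsetsOf (ground h)) ⟩
  scale q (Δ h)
    ∎
  where
  open CongReasoning (GenT GenM GenM)
  ψ = Iso.ψ I
  term : (k : Sym) → Subset (amb k) → ℚ × (Sym × Sym)
  term k S = q * 1ℚ , (restrict k S ⊕ , contract k S (orient k *ₛ shuffleSign (ground k) S))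
  term-iso : ∀ {S} → S ⊆ ground g → (term g S ∷ []) ≈MM (term h (image ψ S) ∷ [])
  term-iso {S} S⊆E = begin
    (q * 1ℚ , (restrict g S ⊕ , contract g S σ)) ∷ []
      ≈⟨ c-gen (gen-l (gen-iso _ _ _ (Iso-restrict I S⊆E ⊕))) ⟩
    (q * 1ℚ , (restrict h (image ψ S) (mS *ₛ ⊕) , contract g S σ)) ∷ []
      ≈⟨ c-gen (gen-r (gen-iso _ _ _ (Iso-contract I S⊆E σ))) ⟩
    (q * 1ℚ , (restrict h (image ψ S) (mS *ₛ ⊕) , contract h (image ψ S) (mV *ₛ σ))) ∷ []
      ≈⟨ reorient-pair (q * 1ℚ) (≡.trans (cong (_*ₛ (mV *ₛ σ)) (*-identityʳ mS)) (Iso-orient-split I S⊆E)) ⟩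
    term h (image ψ S) ∷ []
      ∎
    where
    σ = orient g *ₛ shuffleSign (ground g) S
    mS = mapSign ψ S
    mV = mapSign ψ (ground g ─ S)

Δ̂-resp : ∀ {x y} → x ≈M y → Δ̂ x ≈MM Δ̂ y
Δ̂-resp c-refl                         = c-refl
Δ̂-resp (c-sym p)                      = c-sym (Δ̂-resp p)
Δ̂-resp (c-trans p q)                  = c-trans (Δ̂-resp p) (Δ̂-resp q)
Δ̂-resp (c-++ {x} {x'} {y} {y'} p q) = begin
  Δ̂ (x ++ y)      ≡⟨ concatMap-++ _ x y ⟩
  Δ̂ x ++ Δ̂ y      ≈⟨ c-++ (Δ̂-resp p) (Δ̂-resp q) ⟩
  Δ̂ x' ++ Δ̂ y'    ≡⟨ concatMap-++ _ x' y' ⟨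
  Δ̂ (x' ++ y')    ∎
  where open CongReasoning (GenT GenM GenM)
Δ̂-resp (c-swap {q , a} {r , b})       = ↭⇒Cong (shifts (scale q (Δ a)) (scale r (Δ b)))
Δ̂-resp (c-merge {q} {r} {a})          = begin
  scale q (Δ a) ++ (scale r (Δ a) ++ [])  ≡⟨ cong (scale q (Δ a) ++_) (++-identityʳ _) ⟩
  scale q (Δ a) ++ scale r (Δ a)          ≈⟨ scale-+ q r (Δ a) ⟩
  scale (q + r) (Δ a)                     ≡⟨ ++-identityʳ _ ⟨
  scale (q + r) (Δ a) ++ []               ∎
  where open CongReasoning (GenT GenM GenM)
Δ̂-resp (c-zero {a})                   = c-++ (scale-0 (Δ a)) c-refl
Δ̂-resp (c-gen (gen-neg q g))          = c-++ (Δ-flip q g) c-refl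
Δ̂-resp (c-gen (gen-iso q g h I))      = c-++ (Δ-iso q I) c-refl

ΔWith-choice : ∀ g (c c′ : Choice g) → ΔWith g c ≈MM ΔWith g c′
ΔWith-choice g (c , c-ok) (c′ , c′-ok) = map-Cong (subsetsOf (ground g)) λ S S∈ →
  let S⊆E = ∈-subsetsOf⁻ S∈ in
  reorient-pair 1ℚ (*-cancelʳ-≡ (shuffleSign (ground g) S) _ _ (≡.trans (c-ok S S⊆E) (≡.sym (c′-ok S S⊆E))))

coassoc : ∀ g → IsMatroidSym g → Δ⊗id (Δ g) ≈MMM id⊗Δ (Δ g)
coassoc g@(sym n E _ o) M = begin
  Δ⊗id (Δ g)
    ≡⟨ concatMap-map _ _ (subsetsOf E) ⟩
  concatMap _ (subsetsOf E)
    ≡⟨ concatMap-pairs _ left (subsetsOf E) (λ S → ≡.sym (map-∘ (subsetsOf S))) ⟩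
  map (uncurry left) (nestedPairs E)
    ≈⟨ map-Cong (nestedPairs E) (λ _ ST∈ → let S⊆E , T⊆S = ∈-nestedPairs⁻ ST∈ in left≈right S⊆E T⊆S) ⟩
  map (uncurry right ∘ λ (S , T) → T , S ─ T) (nestedPairs E)
    ≡⟨ map-∘ (nestedPairs E) ⟩
  map (uncurry right) (map (λ (S , T) → T , S ─ T) (nestedPairs E))
    ≈⟨ ↭⇒Cong (map⁺ (uncurry right) (nestedPairs-disjointPairs E)) ⟩
  map (uncurry right) (disjointPairs E)
    ≡⟨ concatMap-pairs _ right (subsetsOf E) (λ T → ≡.sym (map-∘ (subsetsOf (E ─ T)))) ⟨
  concatMap _ (subsetsOf E)
    ≡⟨ concatMap-map _ _ (subsetsOf E) ⟨
  id⊗Δ (Δ g)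
    ∎
  where
  open CongReasoning (GenT GenM (GenT GenM GenM))
  σ : Subset n → Sign
  σ S = o *ₛ shuffleSign E S
  left right : Subset n → Subset n → ℚ × (Sym × (Sym × Sym))
  left  S T = 1ℚ * 1ℚ , (restrict g T ⊕ , (contract (restrict g S ⊕) T (⊕ *ₛ shuffleSign S T) ,
                                          contract g S (σ S)))
  right T U = 1ℚ * 1ℚ , (restrict g T ⊕ , (restrict (contract g T (σ T)) U ⊕ ,
                                          contract (contract g T (σ T)) U (σ T *ₛ shuffleSign (E ─ T) U)))
  left≈right : ∀ {S T} → S ⊆ E → T ⊆ S → (left S T ∷ []) ≈MMM (right T (S ─ T) ∷ [])
  left≈right {S} {T} S⊆E T⊆S = begin
    left S T ∷ []
      ≈⟨ c-gen (gen-r (gen-r (gen-iso _ _ _ (contract-contract g (σ T) (σ S) M S⊆E T⊆S)))) ⟩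
    restrict g T ⊕ ⊗ₗ ((1ℚ * 1ℚ , (contract (restrict g S ⊕) T (⊕ *ₛ shuffleSign S T) ,
                                  contract (contract g T (σ T)) (S ─ T) (σ S))) ∷ [])
      ≈⟨ ⊗-congˡ (restrict g T ⊕) (reorient-pair (1ℚ * 1ℚ) orientations) ⟩
    right T (S ─ T) ∷ []
      ∎
    where
    orientations : (⊕ *ₛ shuffleSign S T) *ₛ σ S ≡ ⊕ *ₛ (σ T *ₛ shuffleSign (E ─ T) (S ─ T))
    orientations = ≡.trans (x∙yz≈y∙xz (shuffleSign S T) o (shuffleSign E S))
      (≡.trans (cong (o *ₛ_) (shuffleSign-trans S⊆E T⊆S)) (≡.sym (*-assoc o (shuffleSign E T) _)))

lemma5p8 :
    -- well defined: independent of the choice of (η|S , η/S)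
    ((g : Sym) → IsMatroidSym g → (c c' : Choice g) → ΔWith g c ≈MM ΔWith g c')
    -- well defined: respects the defining relations of 𝓜
    × ((x y : Lin Sym) → AllMatroid x → AllMatroid y → x ≈M y → Δ̂ x ≈MM Δ̂ y)
    -- coassociative
    × ((g : Sym) → IsMatroidSym g → Δ⊗id (Δ g) ≈MMM id⊗Δ (Δ g))
    -- ε is well defined on 𝓜
    × ((x y : Lin Sym) → AllMatroid x → AllMatroid y → x ≈M y → ε̂ x ≡ ε̂ y)
    -- counital
    × ((g : Sym) → IsMatroidSym g →
         (ε⊗id (Δ g) ≈M ((1ℚ , g) ∷ [])) × (id⊗ε (Δ g) ≈M ((1ℚ , g) ∷ [])))
lemma5p8 =
  (λ g _ → ΔWith-choice g) ,
  (λ _ _ _ _ → Δ̂-resp) ,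
  coassoc ,
  (λ _ _ _ _ → ε̂-resp) ,
  λ g M → counitˡ g M , counitʳ g
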